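{- Let $G$ be an $n$-vertex graph with characteristic polynomial $\chi(G;x)=x^n+c_1x^{n-1}+\cdots+c_{n-1}x+c_n$, and let $f_2(G;x)$ be a monic integer polynomial whose reduction over $\mathbb{F}_2$ is $\chi(G;x)/\operatorname{sqrt}\Phi_2(G;x)$. Then \[ f_2(G;x)\equiv\begin{cases} x^{n/2}+c_2x^{(n-2)/2}+\cdots+c_{n-2}x+c_n \pmod 2 & n \text{ even},\\ x\big(x^{(n-1)/2}+c_2x^{(n-3)/2}+\cdots+c_{n-3}x+c_{n-1}\big)\pmod 2 & n\text{ odd}.\end{cases} \]
   Context: $A$ is the adjacency matrix, $J$ the all-ones matrix, $\chi(G;x)=\det(xI-A)$. $\Phi_2(G;x)=\gcd(\chi(A;x),\chi(A+J;x))$, monic gcd in $\mathbb{F}_2[x]$. For monic $f=\prod_i f_i^{e_i}$ with distinct monic irreducibles $f_i$, $\operatorname{sqrt}(f)=\prod_i f_i^{\lceil e_i/2\rceil}$. -}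

module Defs where

open import Data.Nat as ℕ using (ℕ; zero; suc; _∸_; _<_; _≤_; ⌈_/2⌉; _%_; _≡ᵇ_)
open import Data.Integer as ℤ using (ℤ; +_; 0ℤ; 1ℤ; ∣_∣)
open import Data.Bool using (Bool; true; false; if_then_else_; _xor_; _∧_)
open import Data.List using (List; []; _∷_; map; upTo; foldr)
open import Data.List.Relation.Unary.All using (All)
open import Data.List.Relation.Unary.AllPairs using (AllPairs)
open import Data.Fin using (Fin; zero; suc; punchIn; _≟_)
open import Data.Product using (Σ; _×_; _,_; proj₁; proj₂; ∃-syntax)
open import Data.Sum using (_⊎_)
open import Relation.Nullary using (¬_; does)
open import Relation.Binary.PropositionalEquality using (_≡_)

record Graph (n : ℕ) : Set where
  field
    adj    : Fin n → Fin n → Bool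
    sym    : ∀ i j → adj i j ≡ adj j i
    irrefl : ∀ i → adj i i ≡ false
open Graph public

adjMatrix : ∀ {n} → Graph n → Fin n → Fin n → ℤ
adjMatrix G i j = if adj G i j then 1ℤ else 0ℤ

adjPlusJ : ∀ {n} → Graph n → Fin n → Fin n → ℤ
adjPlusJ G i j = adjMatrix G i j ℤ.+ 1ℤ

-- Integer polynomials: coefficient lists, lowest degree first

ZPoly : Set
ZPoly = List ℤ

coeffZ : ZPoly → ℕ → ℤ
coeffZ []       _       = 0ℤ
coeffZ (a ∷ p)  zero    = a
coeffZ (a ∷ p)  (suc i) = coeffZ p i

infixl 6 _+ᶻ_
infixl 7 _*ᶻ_

_+ᶻ_ : ZPoly → ZPoly → ZPoly
[]      +ᶻ q       = q
(a ∷ p) +ᶻ []      = a ∷ p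
(a ∷ p) +ᶻ (b ∷ q) = (a ℤ.+ b) ∷ (p +ᶻ q)

scaleZ : ℤ → ZPoly → ZPoly
scaleZ c = map (c ℤ.*_)

negZ : ZPoly → ZPoly
negZ = map (λ a → ℤ.- a)

_*ᶻ_ : ZPoly → ZPoly → ZPoly
[]      *ᶻ q = []
(a ∷ p) *ᶻ q = scaleZ a q +ᶻ (0ℤ ∷ (p *ᶻ q))

MonicZ : ZPoly → Set
MonicZ f = Σ ℕ λ d → coeffZ f d ≡ 1ℤ × (∀ i → d < i → coeffZ f i ≡ 0ℤ)

sumFin : ∀ {n} → (Fin n → ZPoly) → ZPoly
sumFin {zero}  f = []
sumFin {suc n} f = f zero +ᶻ sumFin (λ j → f (suc j))

signed : ∀ {n} → Fin n → ZPoly → ZPoly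
signed zero    p = p
signed (suc j) p = negZ (signed j p)

det : ∀ {n} → (Fin n → Fin n → ZPoly) → ZPoly
det {zero}  M = 1ℤ ∷ []
det {suc n} M =
  sumFin (λ j → signed j (M zero j *ᶻ det (λ r c → M (suc r) (punchIn j c))))

charPoly : ∀ {n} → (Fin n → Fin n → ℤ) → ZPoly
charPoly M = det (λ i j →
  (if does (i ≟ j) then 0ℤ ∷ 1ℤ ∷ [] else []) +ᶻ (ℤ.- M i j ∷ []))

χ : ∀ {n} → Graph n → ZPoly
χ G = charPoly (adjMatrix G)

χJ : ∀ {n} → Graph n → ZPoly
χJ G = charPoly (adjPlusJ G)

-- c_k : the coefficient of x^(n-k) in χ(G;x)  (so c_0 is the leading coefficient)
charCoeff : ∀ {n} → Graph n → ℕ → ℤ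
charCoeff {n} G k = coeffZ (χ G) (n ∸ k)

-- Σ_{k=0}^{m} c_{2k} x^{m-k}  (as an integer polynomial)
halfPoly : ∀ {n} → Graph n → ℕ → ZPoly
halfPoly G m = map (λ j → charCoeff G (2 ℕ.* (m ∸ j))) (upTo (suc m))

-- Polynomials over F₂ = Bool (false = 0, true = 1), lowest degree first

F2Poly : Set
F2Poly = List Bool

coeff₂ : F2Poly → ℕ → Bool
coeff₂ []      _       = false
coeff₂ (a ∷ p) zero    = a
coeff₂ (a ∷ p) (suc i) = coeff₂ p i

-- equality of polynomials (coefficientwise; ignores trailing zeros)
infix 4 _≈₂_
_≈₂_ : F2Poly → F2Poly → Set
p ≈₂ q = ∀ i → coeff₂ p i ≡ coeff₂ q i

infixl 6 _+₂_
infixl 7 _*₂_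

_+₂_ : F2Poly → F2Poly → F2Poly
[]      +₂ q       = q
(a ∷ p) +₂ []      = a ∷ p
(a ∷ p) +₂ (b ∷ q) = (a xor b) ∷ (p +₂ q)

_*₂_ : F2Poly → F2Poly → F2Poly
[]      *₂ q = []
(a ∷ p) *₂ q = map (a ∧_) q +₂ (false ∷ (p *₂ q))

one₂ : F2Poly
one₂ = true ∷ []

_^₂_ : F2Poly → ℕ → F2Poly
p ^₂ zero  = one₂
p ^₂ suc e = p *₂ (p ^₂ e)

prod₂ : List F2Poly → F2Poly
prod₂ = foldr _*₂_ one₂

reduceℤ : ℤ → Bool
reduceℤ z = (∣ z ∣ % 2) ≡ᵇ 1

reduce : ZPoly → F2Poly
reduce = map reduceℤ

HasDeg₂ : F2Poly → ℕ → Set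
HasDeg₂ p d = coeff₂ p d ≡ true × (∀ i → d < i → coeff₂ p i ≡ false)

-- monic (over F₂: nonzero)
Monic₂ : F2Poly → Set
Monic₂ p = Σ ℕ λ d → HasDeg₂ p d

infix 4 _∣₂_
_∣₂_ : F2Poly → F2Poly → Set
g ∣₂ f = Σ F2Poly λ q → q *₂ g ≈₂ f

IsMonicGcd₂ : F2Poly → F2Poly → F2Poly → Set
IsMonicGcd₂ d f g =
  Monic₂ d × d ∣₂ f × d ∣₂ g × (∀ e → e ∣₂ f → e ∣₂ g → e ∣₂ d)

IsUnit₂ : F2Poly → Set
IsUnit₂ p = p ≈₂ one₂

MonicIrreducible₂ : F2Poly → Set
MonicIrreducible₂ p =
  (Σ ℕ λ d → 1 ≤ d × HasDeg₂ p d) ×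
  (∀ g h → g *₂ h ≈₂ p → IsUnit₂ g ⊎ IsUnit₂ h)

IsSqrt₂ : F2Poly → F2Poly → Set
IsSqrt₂ s f = Σ (List (F2Poly × ℕ)) λ fs →
  All (λ fe → MonicIrreducible₂ (proj₁ fe)) fs ×
  AllPairs (λ a b → ¬ (proj₁ a ≈₂ proj₁ b)) fs ×
  f ≈₂ prod₂ (map (λ fe → proj₁ fe ^₂ proj₂ fe) fs) ×
  s ≈₂ prod₂ (map (λ fe → proj₁ fe ^₂ ⌈ proj₂ fe /2⌉) fs)

{-# OPTIONS --safe #-}
module Submission where

-- Over F₂ the determinant is the permanent, and for the symmetric matrix xI + A
-- a permutation with a cycle of length ≥ 3 cancels against its inverse, so
-- χ(G) ≡ Σ_matchings x^(n - 2|matching|) (mod 2). Only powers x^i with i ≡ n (mod 2)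
-- occur, hence χ ≡ x^ε h² with ε = n mod 2 and h the reduction of Σ c_{2k} x^(m-k).
-- The matrix determinant lemma gives χ(A + J) = χ + (sum of principal minors of
-- size n - 1) = χ + χ′ = x^ε h² + ε h². So Φ₂ = h², the squarefree-part
-- computation gives sqrt Φ₂ = h, and cancelling h in f₂ h = x^ε h² yields f₂ = x^ε h.

open import Defs hiding (sym)
open import Level using (_⊔_)
open import Algebra.Bundles using (CommutativeRing)
open import Algebra.Structures using (IsCommutativeRing)
open import Data.Bool using (Bool; true; false; _xor_; _∧_; not; if_then_else_)
open import Data.Bool.Properties
  using (xor-assoc; xor-comm; xor-same; xor-identityʳ; xor-annihilates-not; not-involutive; not-distribˡ-xor;
         ∧-distribˡ-xor; ∧-assoc; ∧-comm; ∧-zeroʳ; xor-∧-commutativeRing)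
open import Algebra.Properties.CommutativeSemigroup (CommutativeRing.+-commutativeSemigroup xor-∧-commutativeRing)
  using () renaming (interchange to xor-interchange)
open import Data.Empty using (⊥-elim)
open import Data.Fin using (Fin; zero; suc; punchIn; _≟_)
open import Data.Integer as ℤ using (ℤ; -[1+_]; 0ℤ; 1ℤ; _⊖_)
import Data.Integer.Properties as ℤₚ
open import Data.List using (List; []; _∷_; map; applyUpTo)
open import Data.List.Properties using (map-applyUpTo)
open import Data.List.Relation.Unary.All using (All; []; _∷_)
open import Data.List.Relation.Unary.AllPairs using (AllPairs; []; _∷_)
open import Data.Maybe using (nothing)
open import Data.Nat as ℕ using (ℕ; zero; suc; pred; _≤_; _<_; z≤n; s≤s; _∸_; _%_; _≡ᵇ_; ⌈_/2⌉)
import Data.Nat.Properties as ℕₚ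
open import Data.Product using (Σ; ∃; _×_; _,_; proj₁; proj₂)
open import Data.Sum using (_⊎_; inj₁; inj₂)
open import Data.Vec using (Vec; []; _∷_; tabulate; allFin)
open import Function using (_∘_)
open import Relation.Binary.Bundles using (Setoid)
open import Relation.Binary.Structures using (IsEquivalence)
open import Relation.Binary.PropositionalEquality
  using (_≡_; _≢_; refl; sym; trans; cong; cong₂; subst; ≢-sym; module ≡-Reasoning)
open import Relation.Nullary using (¬_; Dec; yes; no; does)
import Relation.Binary.Reasoning.Setoid as SetoidReasoning
open import Tactic.RingSolver.Core.AlmostCommutativeRing using (fromCommutativeRing)
import Tactic.RingSolver.NonReflective as NonReflective

lengthInduction : ∀ {a p} {A : Set a} (P : ∀ {k} → Vec A k → Set p) → P [] →
  (∀ {k} v (vs : Vec A k) → P vs → (∀ (r : Vec A (pred k)) → P r) → P (v ∷ vs)) →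
  ∀ {k} (vs : Vec A k) → P vs
lengthInduction {A = A} P base step = go _
  where
  go : ∀ k (vs : Vec A k) → P vs
  go zero [] = base
  go (suc zero) (v ∷ []) = step v [] base (λ { [] → base })
  go (suc (suc k)) (v ∷ w ∷ ws) = step v (w ∷ ws) (go (suc k) (w ∷ ws)) (go k)

Characteristic2 : ∀ {c ℓ} → CommutativeRing c ℓ → Set (c ⊔ ℓ)
Characteristic2 R = ∀ x → x + x ≈ 0#
  where open CommutativeRing R

module Permanent {c ℓ} (R : CommutativeRing c ℓ) (x+x≈0 : Characteristic2 R) where

  open CommutativeRing R hiding (zero) renaming (refl to ≈-refl; sym to ≈-sym; trans to ≈-trans)
  open SetoidReasoning setoid
  open NonReflective (fromCommutativeRing R (λ _ → nothing)) using (solve; _⊜_; _⊕_; _⊗_)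

  private variable
    A I J : Set

  -- pickSum vs g sums g v (vs without v) over the entries v of vs.
  pickSum : ∀ {k} → Vec A k → (A → Vec A (pred k) → Carrier) → Carrier
  pickSum [] g = 0#
  pickSum (x ∷ []) g = g x []
  pickSum (x ∷ y ∷ ys) g = g x (y ∷ ys) + pickSum (y ∷ ys) (λ w r → g w (x ∷ r))

  pickSum-cons : ∀ {k} x (xs : Vec A (suc k)) g →
    pickSum (x ∷ xs) g ≈ g x xs + pickSum xs (λ w r → g w (x ∷ r))
  pickSum-cons x (y ∷ ys) g = ≈-refl

  pickSum-cong : ∀ {k} (xs : Vec A k) {g h} → (∀ w r → g w r ≈ h w r) → pickSum xs g ≈ pickSum xs h
  pickSum-cong [] e = ≈-refl
  pickSum-cong (x ∷ []) e = e x []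
  pickSum-cong (x ∷ y ∷ ys) e = +-cong (e x (y ∷ ys)) (pickSum-cong (y ∷ ys) (λ w r → e w (x ∷ r)))

  pickSum-+ : ∀ {k} (xs : Vec A k) g h → pickSum xs (λ w r → g w r + h w r) ≈ pickSum xs g + pickSum xs h
  pickSum-+ [] g h = ≈-sym (+-identityˡ 0#)
  pickSum-+ (x ∷ []) g h = ≈-refl
  pickSum-+ (x ∷ y ∷ ys) g h = ≈-trans (+-cong ≈-refl (pickSum-+ (y ∷ ys) _ _)) (interchange _ _ _ _)
    where
    interchange : ∀ a b c d → (a + b) + (c + d) ≈ (a + c) + (b + d)
    interchange = solve 4 (λ a b c d → ((a ⊕ b) ⊕ (c ⊕ d)) ⊜ ((a ⊕ c) ⊕ (b ⊕ d))) ≈-refl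

  pickSum-*ˡ : ∀ {k} (xs : Vec A k) a g → a * pickSum xs g ≈ pickSum xs (λ w r → a * g w r)
  pickSum-*ˡ [] a g = zeroʳ a
  pickSum-*ˡ (x ∷ []) a g = ≈-refl
  pickSum-*ˡ (x ∷ y ∷ ys) a g = ≈-trans (distribˡ a _ _) (+-cong ≈-refl (pickSum-*ˡ (y ∷ ys) a _))

  pickSum-0 : ∀ {k} (xs : Vec A k) → pickSum xs (λ _ _ → 0#) ≈ 0#
  pickSum-0 [] = ≈-refl
  pickSum-0 (x ∷ []) = ≈-refl
  pickSum-0 (x ∷ y ∷ ys) = ≈-trans (+-identityˡ _) (pickSum-0 (y ∷ ys))

  pickSum-comm : ∀ {k l} (xs : Vec A k) (ys : Vec J l) (φ : A → Vec A (pred k) → J → Vec J (pred l) → Carrier) →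
    pickSum xs (λ w r → pickSum ys (λ u t → φ w r u t)) ≈ pickSum ys (λ u t → pickSum xs (λ w r → φ w r u t))
  pickSum-comm [] ys φ = ≈-sym (pickSum-0 ys)
  pickSum-comm (x ∷ []) ys φ = ≈-refl
  pickSum-comm (x ∷ y ∷ xs) ys φ =
    ≈-trans (+-cong ≈-refl (pickSum-comm (y ∷ xs) ys _)) (≈-sym (pickSum-+ ys _ _))

  pickSum²-swap : ∀ {k} (vs : Vec A (suc k)) (φ : A → A → Vec A (pred k) → Carrier) →
    pickSum vs (λ w r → pickSum r (λ u t → φ w u t)) ≈ pickSum vs (λ w r → pickSum r (λ u t → φ u w t))
  pickSum²-swap (x ∷ []) φ = ≈-refl
  pickSum²-swap (x ∷ y ∷ []) φ = +-comm _ _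
  pickSum²-swap (x ∷ y ∷ z ∷ zs) φ = begin
      pickSum ys (λ u t → φ x u t) + pickSum ys (λ w r → pickSum (x ∷ r) (λ u t → φ w u t))
    ≈⟨ +-cong ≈-refl (pickSum-cong ys (λ w r → pickSum-cons x r (λ u t → φ w u t))) ⟩
      pickSum ys (λ u t → φ x u t) + pickSum ys (λ w r → φ w x r + pickSum r (λ u t → φ w u (x ∷ t)))
    ≈⟨ +-cong ≈-refl (pickSum-+ ys (λ w r → φ w x r) (λ w r → pickSum r (λ u t → φ w u (x ∷ t)))) ⟩
      pickSum ys (λ u t → φ x u t) + (pickSum ys (λ w r → φ w x r) + pickSum ys (λ w r → pickSum r (λ u t → φ w u (x ∷ t))))
    ≈⟨ +-cong ≈-refl (+-cong ≈-refl (pickSum²-swap ys (λ w u t → φ w u (x ∷ t)))) ⟩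
      pickSum ys (λ u t → φ x u t) + (pickSum ys (λ w r → φ w x r) + pickSum ys (λ w r → pickSum r (λ u t → φ u w (x ∷ t))))
    ≈⟨ solve 3 (λ a b c → (a ⊕ (b ⊕ c)) ⊜ (b ⊕ (a ⊕ c))) ≈-refl _ _ _ ⟩
      pickSum ys (λ w r → φ w x r) + (pickSum ys (λ u t → φ x u t) + pickSum ys (λ w r → pickSum r (λ u t → φ u w (x ∷ t))))
    ≈⟨ +-cong ≈-refl (≈-sym (pickSum-+ ys (λ w r → φ x w r) (λ w r → pickSum r (λ u t → φ u w (x ∷ t))))) ⟩
      pickSum ys (λ w r → φ w x r) + pickSum ys (λ w r → φ x w r + pickSum r (λ u t → φ u w (x ∷ t)))
    ≈⟨ +-cong ≈-refl (pickSum-cong ys (λ w r → ≈-sym (pickSum-cons x r (λ u t → φ u w t)))) ⟩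
      pickSum ys (λ w r → φ w x r) + pickSum ys (λ w r → pickSum (x ∷ r) (λ u t → φ u w t))
    ∎
    where ys = y ∷ z ∷ zs

  -- Each remainder t arises from picking the same two entries in either order,
  -- so the terms cancel in pairs.
  pickSum²-remainder≈0 : ∀ {k} (vs : Vec A (suc k)) (ψ : Vec A (pred k) → Carrier) →
    pickSum vs (λ w r → pickSum r (λ u t → ψ t)) ≈ 0#
  pickSum²-remainder≈0 (x ∷ []) ψ = ≈-refl
  pickSum²-remainder≈0 (x ∷ y ∷ []) ψ = x+x≈0 _
  pickSum²-remainder≈0 (x ∷ y ∷ z ∷ zs) ψ = begin
      pickSum ys (λ u t → ψ t) + pickSum ys (λ w r → pickSum (x ∷ r) (λ u t → ψ t))
    ≈⟨ +-cong ≈-refl (pickSum-cong ys (λ w r → pickSum-cons x r (λ u t → ψ t))) ⟩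
      pickSum ys (λ u t → ψ t) + pickSum ys (λ w r → ψ r + pickSum r (λ u t → ψ (x ∷ t)))
    ≈⟨ +-cong ≈-refl (pickSum-+ ys (λ w r → ψ r) (λ w r → pickSum r (λ u t → ψ (x ∷ t)))) ⟩
      pickSum ys (λ u t → ψ t) + (pickSum ys (λ w r → ψ r) + pickSum ys (λ w r → pickSum r (λ u t → ψ (x ∷ t))))
    ≈⟨ +-cong ≈-refl (+-cong ≈-refl (pickSum²-remainder≈0 ys (λ t → ψ (x ∷ t)))) ⟩
      pickSum ys (λ u t → ψ t) + (pickSum ys (λ w r → ψ r) + 0#)
    ≈⟨ ≈-trans (≈-sym (+-assoc _ _ _)) (≈-trans (+-identityʳ _) (x+x≈0 _)) ⟩
      0#
    ∎
    where ys = y ∷ z ∷ zs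

  pickSum²-diagonal : ∀ {k} (vs : Vec A (suc k)) (φ : A → Vec A k → A → Vec A k → Carrier) →
    (∀ a r b t → φ a r b t ≈ φ b t a r) →
    pickSum vs (λ c cs → pickSum vs (λ r rs → φ c cs r rs)) ≈ pickSum vs (λ c cs → φ c cs c cs)
  pickSum²-diagonal (x ∷ []) φ φ-sym = ≈-refl
  pickSum²-diagonal (x ∷ y ∷ ys) φ φ-sym = begin
      pickSum (x ∷ zs) (λ r rs → φ x zs r rs) + pickSum zs (λ w r → pickSum (x ∷ zs) (λ r' rs → φ w (x ∷ r) r' rs))
    ≈⟨ +-cong ≈-refl (pickSum-cong zs (λ w r → pickSum-cons x zs (λ r' rs → φ w (x ∷ r) r' rs))) ⟩
      (φ x zs x zs + pickSum zs (λ u t → φ x zs u (x ∷ t)))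
       + pickSum zs (λ w r → φ w (x ∷ r) x zs + pickSum zs (λ u t → φ w (x ∷ r) u (x ∷ t)))
    ≈⟨ +-cong ≈-refl (pickSum-+ zs _ _) ⟩
      (φ x zs x zs + pickSum zs (λ u t → φ x zs u (x ∷ t)))
       + (pickSum zs (λ w r → φ w (x ∷ r) x zs) + pickSum zs (λ w r → pickSum zs (λ u t → φ w (x ∷ r) u (x ∷ t))))
    ≈⟨ +-cong (+-cong ≈-refl (pickSum-cong zs (λ u t → φ-sym x zs u (x ∷ t))))
              (+-cong ≈-refl (pickSum²-diagonal zs (λ a r b t → φ a (x ∷ r) b (x ∷ t))
                                                  (λ a r b t → φ-sym a (x ∷ r) b (x ∷ t)))) ⟩
      (φ x zs x zs + pickSum zs (λ u t → φ u (x ∷ t) x zs))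
       + (pickSum zs (λ w r → φ w (x ∷ r) x zs) + pickSum zs (λ w r → φ w (x ∷ r) w (x ∷ r)))
    ≈⟨ cancel-middle _ _ _ ⟩
      φ x zs x zs + pickSum zs (λ w r → φ w (x ∷ r) w (x ∷ r))
    ∎
    where
    zs = y ∷ ys
    cancel-middle : ∀ a b c → (a + b) + (b + c) ≈ a + c
    cancel-middle a b c = begin
        (a + b) + (b + c)
      ≈⟨ solve 3 (λ a b c → ((a ⊕ b) ⊕ (b ⊕ c)) ⊜ (a ⊕ ((b ⊕ b) ⊕ c))) ≈-refl a b c ⟩
        a + ((b + b) + c)
      ≈⟨ +-cong ≈-refl (≈-trans (+-cong (x+x≈0 b) ≈-refl) (+-identityˡ c)) ⟩
        a + c
      ∎

  -- Laplace expansion along the first row without signs: in characteristic 2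
  -- the permanent is the determinant.
  permanent : (I → J → Carrier) → ∀ {n} → Vec I n → Vec J n → Carrier
  permanent M [] [] = 1#
  permanent M (r ∷ rs) cs = pickSum cs (λ c cs' → M r c * permanent M rs cs')

  permanent-cong : ∀ {M M' : I → J → Carrier} → (∀ i j → M i j ≈ M' i j) →
    ∀ {n} (rs : Vec I n) cs → permanent M rs cs ≈ permanent M' rs cs
  permanent-cong e [] [] = ≈-refl
  permanent-cong e (r ∷ rs) cs = pickSum-cong cs (λ c cs' → *-cong (e r c) (permanent-cong e rs cs'))

  permanent-columnExpansion : ∀ (M : I → J → Carrier) {n} (rs : Vec I (suc n)) c cs →
    permanent M rs (c ∷ cs) ≈ pickSum rs (λ r rs' → M r c * permanent M rs' cs)
  permanent-columnExpansion M (r ∷ []) c [] = ≈-refl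
  permanent-columnExpansion M (r ∷ s ∷ ss) c (d ∷ ds) = +-cong ≈-refl (begin
      pickSum (d ∷ ds) (λ c' cs → M r c' * permanent M (s ∷ ss) (c ∷ cs))
    ≈⟨ pickSum-cong (d ∷ ds) (λ c' cs → *-cong ≈-refl (permanent-columnExpansion M (s ∷ ss) c cs)) ⟩
      pickSum (d ∷ ds) (λ c' cs → M r c' * pickSum (s ∷ ss) (λ r' rs → M r' c * permanent M rs cs))
    ≈⟨ pickSum-cong (d ∷ ds) (λ c' cs → pickSum-*ˡ (s ∷ ss) (M r c') _) ⟩
      pickSum (d ∷ ds) (λ c' cs → pickSum (s ∷ ss) (λ r' rs → M r c' * (M r' c * permanent M rs cs)))
    ≈⟨ pickSum-comm (d ∷ ds) (s ∷ ss) _ ⟩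
      pickSum (s ∷ ss) (λ r' rs → pickSum (d ∷ ds) (λ c' cs → M r c' * (M r' c * permanent M rs cs)))
    ≈⟨ pickSum-cong (s ∷ ss) (λ r' rs → pickSum-cong (d ∷ ds) (λ c' cs → x∙yz≈y∙xz _ _ _)) ⟩
      pickSum (s ∷ ss) (λ r' rs → pickSum (d ∷ ds) (λ c' cs → M r' c * (M r c' * permanent M rs cs)))
    ≈⟨ pickSum-cong (s ∷ ss) (λ r' rs → ≈-sym (pickSum-*ˡ (d ∷ ds) (M r' c) _)) ⟩
      pickSum (s ∷ ss) (λ r' rs → M r' c * pickSum (d ∷ ds) (λ c' cs → M r c' * permanent M rs cs))
    ∎)
    where
    x∙yz≈y∙xz : ∀ a b x → a * (b * x) ≈ b * (a * x)
    x∙yz≈y∙xz = solve 3 (λ a b x → (a ⊗ (b ⊗ x)) ⊜ (b ⊗ (a ⊗ x))) ≈-refl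

  permanent-transpose : ∀ (M : I → J → Carrier) {n} (rs : Vec I n) cs →
    permanent M rs cs ≈ permanent (λ j i → M i j) cs rs
  permanent-transpose M [] [] = ≈-refl
  permanent-transpose M (r ∷ rs) cs =
    ≈-trans (pickSum-cong cs (λ c cs' → *-cong ≈-refl (permanent-transpose M rs cs')))
            (≈-sym (permanent-columnExpansion (λ j i → M i j) cs r rs))

  module _ (M : I → I → Carrier) where

    sq : I → I → Carrier
    sq v w = M v w * M v w

    -- Sum over the partial matchings of vs: an unmatched v contributes M v v,
    -- a matched pair v w contributes (M v w)².
    matchingSumOfLength : ∀ k → Vec I k → Carrier
    matchingSumOfLength zero [] = 1#
    matchingSumOfLength (suc zero) (v ∷ vs) =
      M v v * matchingSumOfLength zero vs + pickSum vs (λ w r → sq v w * matchingSumOfLength zero r)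
    matchingSumOfLength (suc (suc k)) (v ∷ vs) =
      M v v * matchingSumOfLength (suc k) vs + pickSum vs (λ w r → sq v w * matchingSumOfLength k r)

    matchingSum : ∀ {k} → Vec I k → Carrier
    matchingSum {k} = matchingSumOfLength k

    matchingSum-step : ∀ {k} v (vs : Vec I k) →
      matchingSum (v ∷ vs) ≈ M v v * matchingSum vs + pickSum vs (λ w r → sq v w * matchingSum r)
    matchingSum-step {zero} v vs = ≈-refl
    matchingSum-step {suc k} v vs = ≈-refl

    deletionSum : ∀ {k} → Vec I k → Carrier
    deletionSum vs = pickSum vs (λ _ r → matchingSum r)

  -- Only involutions survive: the other permutations pair off with their inverses.
  permanent≈matchingSum : ∀ (M : I → I → Carrier) → (∀ i j → M i j ≈ M j i) →
    ∀ {k} (vs : Vec I k) → permanent M vs vs ≈ matchingSum M vs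
  permanent≈matchingSum {I = I} M M-sym = lengthInduction (λ vs → permanent M vs vs ≈ matchingSum M vs) ≈-refl step
    where
    permanent-swap : ∀ {k} (r t : Vec I k) → permanent M t r ≈ permanent M r t
    permanent-swap r t = ≈-trans (permanent-transpose M t r) (permanent-cong (λ i j → M-sym j i) r t)

    step : ∀ {k} v (vs : Vec I k) → permanent M vs vs ≈ matchingSum M vs →
      (∀ r → permanent M r r ≈ matchingSum M r) → permanent M (v ∷ vs) (v ∷ vs) ≈ matchingSum M (v ∷ vs)
    step v [] ih ihr = ≈-sym (+-identityʳ _)
    step v (y ∷ ys) ih ihr = begin
        permanent M (v ∷ vs) (v ∷ vs)
      ≈⟨ pickSum-cons v vs (λ c cs → M v c * permanent M vs cs) ⟩
        M v v * permanent M vs vs + pickSum vs (λ c cs → M v c * permanent M vs (v ∷ cs))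
      ≈⟨ +-cong (*-cong ≈-refl ih) (pickSum-cong vs (λ c cs →
           ≈-trans (*-cong ≈-refl (permanent-columnExpansion M vs v cs)) (pickSum-*ˡ vs (M v c) _))) ⟩
        M v v * matchingSum M vs + pickSum vs (λ c cs → pickSum vs (λ r rs → M v c * (M r v * permanent M rs cs)))
      ≈⟨ +-cong ≈-refl (pickSum²-diagonal vs (λ c cs r rs → M v c * (M r v * permanent M rs cs)) φ-sym) ⟩
        M v v * matchingSum M vs + pickSum vs (λ c cs → M v c * (M c v * permanent M cs cs))
      ≈⟨ +-cong ≈-refl (pickSum-cong vs (λ c cs →
           ≈-trans (≈-sym (*-assoc _ _ _)) (*-cong (*-cong ≈-refl (M-sym c v)) (ihr cs)))) ⟩
        M v v * matchingSum M vs + pickSum vs (λ c cs → sq M v c * matchingSum M cs)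
      ≈⟨ matchingSum-step M v vs ⟨
        matchingSum M (v ∷ vs)
      ∎
      where
      vs = y ∷ ys
      φ-sym : ∀ a r b t → M v a * (M b v * permanent M t r) ≈ M v b * (M a v * permanent M r t)
      φ-sym a r b t = begin
          M v a * (M b v * permanent M t r)
        ≈⟨ *-cong ≈-refl (*-cong (M-sym b v) (permanent-swap r t)) ⟩
          M v a * (M v b * permanent M r t)
        ≈⟨ solve 3 (λ a b x → (a ⊗ (b ⊗ x)) ⊜ (b ⊗ (a ⊗ x))) ≈-refl _ _ _ ⟩
          M v b * (M v a * permanent M r t)
        ≈⟨ *-cong ≈-refl (*-cong (M-sym v a) ≈-refl) ⟩
          M v b * (M a v * permanent M r t)
        ∎

  deletionSum-step : ∀ (M : I → I → Carrier) {k} v (vs : Vec I (suc k)) →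
    deletionSum M (v ∷ vs) ≈ matchingSum M vs + (M v v * deletionSum M vs + pickSum vs (λ w r → sq M v w * deletionSum M r))
  deletionSum-step M v vs = begin
      deletionSum M (v ∷ vs)
    ≈⟨ pickSum-cons v vs (λ w r → matchingSum M r) ⟩
      matchingSum M vs + pickSum vs (λ w r → matchingSum M (v ∷ r))
    ≈⟨ +-cong ≈-refl (pickSum-cong vs (λ w r → matchingSum-step M v r)) ⟩
      matchingSum M vs + pickSum vs (λ w r → M v v * matchingSum M r + pickSum r (λ u t → sq M v u * matchingSum M t))
    ≈⟨ +-cong ≈-refl (pickSum-+ vs (λ w r → M v v * matchingSum M r) (λ w r → pickSum r (λ u t → sq M v u * matchingSum M t))) ⟩
      matchingSum M vs + (pickSum vs (λ w r → M v v * matchingSum M r)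
                          + pickSum vs (λ w r → pickSum r (λ u t → sq M v u * matchingSum M t)))
    ≈⟨ +-cong ≈-refl (+-cong (≈-sym (pickSum-*ˡ vs (M v v) _)) (pickSum²-swap vs (λ w u t → sq M v u * matchingSum M t))) ⟩
      matchingSum M vs + (M v v * deletionSum M vs + pickSum vs (λ w r → pickSum r (λ u t → sq M v w * matchingSum M t)))
    ≈⟨ +-cong ≈-refl (+-cong ≈-refl (pickSum-cong vs (λ w r → ≈-sym (pickSum-*ˡ r (sq M v w) _)))) ⟩
      matchingSum M vs + (M v v * deletionSum M vs + pickSum vs (λ w r → sq M v w * deletionSum M r))
    ∎

  -- The matrix determinant lemma det(M + J) = det M + 1ᵀ adj(M) 1, where in
  -- characteristic 2 only the diagonal of the symmetric adj(M) survives.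
  matchingSum-+1 : ∀ (M N : I → I → Carrier) → (∀ i j → N i j ≈ M i j + 1#) →
    ∀ {k} (vs : Vec I k) → matchingSum N vs ≈ matchingSum M vs + deletionSum M vs
  matchingSum-+1 {I = I} M N N≈M+1 = lengthInduction (λ vs → matchingSum N vs ≈ matchingSum M vs + deletionSum M vs)
    (≈-sym (+-identityʳ _)) step
    where
    [m+1]*x : ∀ m x → (m + 1#) * x ≈ m * x + x
    [m+1]*x m x = ≈-trans (distribʳ x m 1#) (+-cong ≈-refl (*-identityˡ x))

    sq-N : ∀ v w → sq N v w ≈ sq M v w + 1#
    sq-N v w = begin
        N v w * N v w
      ≈⟨ *-cong (N≈M+1 v w) (N≈M+1 v w) ⟩
        (M v w + 1#) * (M v w + 1#)
      ≈⟨ solve 2 (λ m o → ((m ⊕ o) ⊗ (m ⊕ o)) ⊜ ((m ⊗ m ⊕ o ⊗ o) ⊕ (m ⊗ o ⊕ m ⊗ o))) ≈-refl (M v w) 1# ⟩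
        (sq M v w + 1# * 1#) + (M v w * 1# + M v w * 1#)
      ≈⟨ ≈-trans (+-cong (+-cong ≈-refl (*-identityˡ 1#)) (x+x≈0 _)) (+-identityʳ _) ⟩
        sq M v w + 1#
      ∎

    step : ∀ {k} v (vs : Vec I k) → matchingSum N vs ≈ matchingSum M vs + deletionSum M vs →
      (∀ r → matchingSum N r ≈ matchingSum M r + deletionSum M r) →
      matchingSum N (v ∷ vs) ≈ matchingSum M (v ∷ vs) + deletionSum M (v ∷ vs)
    step v [] ih ihr = begin
        N v v * 1# + 0#
      ≈⟨ ≈-trans (+-identityʳ _) (≈-trans (*-identityʳ _) (N≈M+1 v v)) ⟩
        M v v + 1#
      ≈⟨ +-cong (≈-trans (+-identityʳ _) (*-identityʳ _)) ≈-refl ⟨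
        (M v v * 1# + 0#) + 1#
      ∎
    step v (y ∷ ys) ih ihr = begin
        matchingSum N (v ∷ vs)
      ≈⟨ matchingSum-step N v vs ⟩
        N v v * matchingSum N vs + pickSum vs (λ w r → sq N v w * matchingSum N r)
      ≈⟨ +-cong (*-cong (N≈M+1 v v) ih) (pickSum-cong vs (λ w r → *-cong (sq-N v w) (ihr r))) ⟩
        (M v v + 1#) * (F + S) + pickSum vs (λ w r → (sq M v w + 1#) * (matchingSum M r + deletionSum M r))
      ≈⟨ +-cong ≈-refl (pickSum-cong vs (λ w r → ≈-trans ([m+1]*x (sq M v w) _) (+-cong (distribˡ _ _ _) ≈-refl))) ⟩
        (M v v + 1#) * (F + S)
          + pickSum vs (λ w r → (sq M v w * matchingSum M r + sq M v w * deletionSum M r) + (matchingSum M r + deletionSum M r))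
      ≈⟨ +-cong ≈-refl (≈-trans (pickSum-+ vs _ _) (+-cong (pickSum-+ vs _ _) (pickSum-+ vs _ _))) ⟩
        (M v v + 1#) * (F + S) + ((Fᵥ + Sᵥ) + (S + pickSum vs (λ w r → deletionSum M r)))
      ≈⟨ +-cong ([m+1]*x _ _)
                (+-cong ≈-refl (≈-trans (+-cong ≈-refl (pickSum²-remainder≈0 vs (matchingSum M))) (+-identityʳ _))) ⟩
        (M v v * (F + S) + (F + S)) + ((Fᵥ + Sᵥ) + S)
      ≈⟨ solve 5 (λ m f s a b → ((m ⊗ (f ⊕ s) ⊕ (f ⊕ s)) ⊕ ((a ⊕ b) ⊕ s))
                             ⊜ (((m ⊗ f ⊕ a) ⊕ (f ⊕ (m ⊗ s ⊕ b))) ⊕ (s ⊕ s))) ≈-refl (M v v) F S Fᵥ Sᵥ ⟩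
        ((M v v * F + Fᵥ) + (F + (M v v * S + Sᵥ))) + (S + S)
      ≈⟨ ≈-trans (+-cong ≈-refl (x+x≈0 _)) (+-identityʳ _) ⟩
        (M v v * F + Fᵥ) + (F + (M v v * S + Sᵥ))
      ≈⟨ +-cong (matchingSum-step M v vs) (deletionSum-step M v vs) ⟨
        matchingSum M (v ∷ vs) + deletionSum M (v ∷ vs)
      ∎
      where
      vs = y ∷ ys
      F = matchingSum M vs
      S = deletionSum M vs
      Fᵥ = pickSum vs (λ w r → sq M v w * matchingSum M r)
      Sᵥ = pickSum vs (λ w r → sq M v w * deletionSum M r)

-- Opened only here: inside Permanent, _+_ and _*_ are the ring operations.
open import Data.Nat using (_+_; _*_)

coeff-+ : ∀ p q i → coeff₂ (p +₂ q) i ≡ coeff₂ p i xor coeff₂ q i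
coeff-+ [] q i = refl
coeff-+ (a ∷ p) [] zero = sym (xor-identityʳ a)
coeff-+ (a ∷ p) [] (suc i) = sym (xor-identityʳ _)
coeff-+ (a ∷ p) (b ∷ q) zero = refl
coeff-+ (a ∷ p) (b ∷ q) (suc i) = coeff-+ p q i

coeff-scale : ∀ a q i → coeff₂ (map (a ∧_) q) i ≡ a ∧ coeff₂ q i
coeff-scale a [] i = sym (∧-zeroʳ a)
coeff-scale a (b ∷ q) zero = refl
coeff-scale a (b ∷ q) (suc i) = coeff-scale a q i

coeff-[] : ∀ i → coeff₂ [] i ≡ false
coeff-[] zero = refl
coeff-[] (suc i) = refl

-- Equality _≈₂_ wrapped in a record, so that both polynomials can be
-- inferred from a proof.
infix 4 _≋_
record _≋_ (p q : F2Poly) : Set where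
  constructor coeffwise
  field coeff-≡ : p ≈₂ q
open _≋_

x·_ : F2Poly → F2Poly
x· p = false ∷ p

X : F2Poly
X = x· one₂

≋-refl : ∀ {p} → p ≋ p
≋-refl = coeffwise (λ i → refl)

≋-sym : ∀ {p q} → p ≋ q → q ≋ p
≋-sym e = coeffwise (λ i → sym (coeff-≡ e i))

≋-trans : ∀ {p q r} → p ≋ q → q ≋ r → p ≋ r
≋-trans e f = coeffwise (λ i → trans (coeff-≡ e i) (coeff-≡ f i))

≋-reflexive : ∀ {p q} → p ≡ q → p ≋ q
≋-reflexive refl = ≋-refl

≋-isEquivalence : IsEquivalence _≋_
≋-isEquivalence = record { refl = ≋-refl ; sym = ≋-sym ; trans = ≋-trans }

≋-setoid : Setoid _ _
≋-setoid = record { isEquivalence = ≋-isEquivalence }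

module ≋-Reasoning = SetoidReasoning ≋-setoid

∷-cong : ∀ {a b p q} → a ≡ b → p ≋ q → (a ∷ p) ≋ (b ∷ q)
∷-cong e f = coeffwise (λ { zero → e ; (suc i) → coeff-≡ f i })

∷-injectiveʳ : ∀ {a b p q} → (a ∷ p) ≋ (b ∷ q) → p ≋ q
∷-injectiveʳ e = coeffwise (λ i → coeff-≡ e (suc i))

∷≋[]⇒≋[] : ∀ {a p} → (a ∷ p) ≋ [] → p ≋ []
∷≋[]⇒≋[] e = coeffwise (λ i → coeff-≡ e (suc i))

x·[] : x· [] ≋ []
x·[] = coeffwise (λ { zero → refl ; (suc i) → refl })

+-cong : ∀ {p p' q q'} → p ≋ p' → q ≋ q' → (p +₂ q) ≋ (p' +₂ q')
+-cong {p} {p'} {q} {q'} e f = coeffwise (λ i → trans (coeff-+ p q i)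
  (trans (cong₂ _xor_ (coeff-≡ e i) (coeff-≡ f i)) (sym (coeff-+ p' q' i))))

+-assoc : ∀ p q r → ((p +₂ q) +₂ r) ≋ (p +₂ (q +₂ r))
+-assoc p q r = coeffwise coeffs
  where
  coeffs : ∀ i → coeff₂ ((p +₂ q) +₂ r) i ≡ coeff₂ (p +₂ (q +₂ r)) i
  coeffs i rewrite coeff-+ (p +₂ q) r i | coeff-+ p q i | coeff-+ p (q +₂ r) i | coeff-+ q r i =
    xor-assoc (coeff₂ p i) (coeff₂ q i) (coeff₂ r i)

+-comm : ∀ p q → (p +₂ q) ≋ (q +₂ p)
+-comm p q = coeffwise (λ i → trans (coeff-+ p q i) (trans (xor-comm (coeff₂ p i) (coeff₂ q i)) (sym (coeff-+ q p i))))

+-identityʳ : ∀ p → (p +₂ []) ≋ p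
+-identityʳ p = coeffwise (λ i → trans (coeff-+ p [] i) (xor-identityʳ _))

+-same : ∀ p → (p +₂ p) ≋ []
+-same p = coeffwise (λ i → trans (coeff-+ p p i) (trans (xor-same (coeff₂ p i)) (sym (coeff-[] i))))

+-interchange : ∀ p q r s → ((p +₂ q) +₂ (r +₂ s)) ≋ ((p +₂ r) +₂ (q +₂ s))
+-interchange p q r s = coeffwise coeffs
  where
  coeffs : ∀ i → coeff₂ ((p +₂ q) +₂ (r +₂ s)) i ≡ coeff₂ ((p +₂ r) +₂ (q +₂ s)) i
  coeffs i rewrite coeff-+ (p +₂ q) (r +₂ s) i | coeff-+ (p +₂ r) (q +₂ s) i
                 | coeff-+ p q i | coeff-+ r s i | coeff-+ p r i | coeff-+ q s i =
    xor-interchange (coeff₂ p i) (coeff₂ q i) (coeff₂ r i) (coeff₂ s i)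

scale-cong : ∀ a {q q'} → q ≋ q' → map (a ∧_) q ≋ map (a ∧_) q'
scale-cong a {q} {q'} e = coeffwise (λ i → trans (coeff-scale a q i) (trans (cong (a ∧_) (coeff-≡ e i)) (sym (coeff-scale a q' i))))

scale-+ : ∀ a q r → map (a ∧_) (q +₂ r) ≋ (map (a ∧_) q +₂ map (a ∧_) r)
scale-+ a q r = coeffwise coeffs
  where
  coeffs : ∀ i → coeff₂ (map (a ∧_) (q +₂ r)) i ≡ coeff₂ (map (a ∧_) q +₂ map (a ∧_) r) i
  coeffs i rewrite coeff-scale a (q +₂ r) i | coeff-+ q r i | coeff-+ (map (a ∧_) q) (map (a ∧_) r) i
                 | coeff-scale a q i | coeff-scale a r i = ∧-distribˡ-xor a _ _

scale-false : ∀ q → map (false ∧_) q ≋ []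
scale-false q = coeffwise (λ i → trans (coeff-scale false q i) (sym (coeff-[] i)))

scale-true : ∀ q → map (true ∧_) q ≋ q
scale-true q = coeffwise (coeff-scale true q)

scale-scale : ∀ a b q → map (a ∧_) (map (b ∧_) q) ≋ map ((a ∧ b) ∧_) q
scale-scale a b q = coeffwise coeffs
  where
  coeffs : ∀ i → coeff₂ (map (a ∧_) (map (b ∧_) q)) i ≡ coeff₂ (map ((a ∧ b) ∧_) q) i
  coeffs i rewrite coeff-scale a (map (b ∧_) q) i | coeff-scale b q i | coeff-scale (a ∧ b) q i =
    sym (∧-assoc a b _)

*-zeroˡ : ∀ {p} q → p ≋ [] → (p *₂ q) ≋ []
*-zeroˡ {[]} q e = ≋-refl
*-zeroˡ {a ∷ p} q e with coeff-≡ e zero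
... | refl = ≋-trans (+-cong (scale-false q) (∷-cong refl (*-zeroˡ q (∷≋[]⇒≋[] e)))) x·[]

*-zeroʳ : ∀ p → (p *₂ []) ≋ []
*-zeroʳ [] = ≋-refl
*-zeroʳ (a ∷ p) = ≋-trans (∷-cong refl (*-zeroʳ p)) x·[]

*-congˡ : ∀ {p p'} q → p ≋ p' → (p *₂ q) ≋ (p' *₂ q)
*-congˡ {[]} {p'} q e = ≋-sym (*-zeroˡ q (≋-sym e))
*-congˡ {a ∷ p} {[]} q e = *-zeroˡ q e
*-congˡ {a ∷ p} {b ∷ p'} q e with coeff-≡ e zero
... | refl = +-cong ≋-refl (∷-cong refl (*-congˡ q (∷-injectiveʳ e)))

*-congʳ : ∀ p {q q'} → q ≋ q' → (p *₂ q) ≋ (p *₂ q')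
*-congʳ [] e = ≋-refl
*-congʳ (a ∷ p) e = +-cong (scale-cong a e) (∷-cong refl (*-congʳ p e))

*-cong : ∀ {p p' q q'} → p ≋ p' → q ≋ q' → (p *₂ q) ≋ (p' *₂ q')
*-cong {p' = p'} {q = q} e f = ≋-trans (*-congˡ q e) (*-congʳ p' f)

*-∷ʳ : ∀ p b q → (p *₂ (b ∷ q)) ≋ (map (b ∧_) p +₂ x· (p *₂ q))
*-∷ʳ [] b q = ≋-sym x·[]
*-∷ʳ (a ∷ p) b q = ∷-cong (cong (_xor false) (∧-comm a b)) (begin
    map (a ∧_) q +₂ (p *₂ (b ∷ q))
  ≈⟨ +-cong ≋-refl (*-∷ʳ p b q) ⟩
    map (a ∧_) q +₂ (map (b ∧_) p +₂ x· (p *₂ q))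
  ≈⟨ +-assoc (map (a ∧_) q) _ _ ⟨
    (map (a ∧_) q +₂ map (b ∧_) p) +₂ x· (p *₂ q)
  ≈⟨ +-cong (+-comm (map (a ∧_) q) _) ≋-refl ⟩
    (map (b ∧_) p +₂ map (a ∧_) q) +₂ x· (p *₂ q)
  ≈⟨ +-assoc (map (b ∧_) p) _ _ ⟩
    map (b ∧_) p +₂ (map (a ∧_) q +₂ x· (p *₂ q))
  ∎)
  where open ≋-Reasoning

*-comm : ∀ p q → (p *₂ q) ≋ (q *₂ p)
*-comm [] q = ≋-sym (*-zeroʳ q)
*-comm (a ∷ p) q = ≋-sym (≋-trans (*-∷ʳ q a p) (+-cong ≋-refl (∷-cong refl (*-comm q p))))

*-distribˡ-+ : ∀ p q r → (p *₂ (q +₂ r)) ≋ ((p *₂ q) +₂ (p *₂ r))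
*-distribˡ-+ [] q r = ≋-refl
*-distribˡ-+ (a ∷ p) q r =
  ≋-trans (+-cong (scale-+ a q r) (∷-cong refl (*-distribˡ-+ p q r)))
          (+-interchange (map (a ∧_) q) (map (a ∧_) r) (x· (p *₂ q)) (x· (p *₂ r)))

*-distribʳ-+ : ∀ p q r → ((q +₂ r) *₂ p) ≋ ((q *₂ p) +₂ (r *₂ p))
*-distribʳ-+ p q r = ≋-trans (*-comm (q +₂ r) p) (≋-trans (*-distribˡ-+ p q r) (+-cong (*-comm p q) (*-comm p r)))

scale-* : ∀ a q r → (map (a ∧_) q *₂ r) ≋ map (a ∧_) (q *₂ r)
scale-* a [] r = ≋-refl
scale-* a (b ∷ q) r = ≋-trans (+-cong ≋-refl (∷-cong refl (scale-* a q r)))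
  (≋-sym (≋-trans (scale-+ a (map (b ∧_) r) (x· (q *₂ r))) (+-cong (scale-scale a b r) (∷-cong (∧-zeroʳ a) ≋-refl))))

*-assoc : ∀ p q r → ((p *₂ q) *₂ r) ≋ (p *₂ (q *₂ r))
*-assoc [] q r = ≋-refl
*-assoc (a ∷ p) q r =
  ≋-trans (*-distribʳ-+ r (map (a ∧_) q) (x· (p *₂ q)))
          (+-cong (scale-* a q r) (≋-trans (+-cong (scale-false r) ≋-refl) (∷-cong refl (*-assoc p q r))))

*-identityˡ : ∀ p → (one₂ *₂ p) ≋ p
*-identityˡ p = ≋-trans (+-cong (scale-true p) x·[]) (+-identityʳ p)

*-identityʳ : ∀ p → (p *₂ one₂) ≋ p
*-identityʳ p = ≋-trans (*-comm p one₂) (*-identityˡ p)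

X*≋x· : ∀ q → (X *₂ q) ≋ x· q
X*≋x· q = +-cong (scale-false q) (∷-cong refl (*-identityˡ q))

+-*-isCommutativeRing : IsCommutativeRing _≋_ _+₂_ _*₂_ (λ p → p) [] one₂
+-*-isCommutativeRing = record
  { isRing = record
    { +-isAbelianGroup = record
      { isGroup = record
        { isMonoid = record
          { isSemigroup = record
            { isMagma = record
              { isEquivalence = ≋-isEquivalence
              ; ∙-cong = +-cong }
            ; assoc = +-assoc }
          ; identity = (λ p → ≋-refl) , +-identityʳ }
        ; inverse = +-same , +-same
        ; ⁻¹-cong = λ e → e }
      ; comm = +-comm }
    ; *-cong = *-cong
    ; *-assoc = *-assoc
    ; *-identity = *-identityˡ , *-identityʳ
    ; distrib = *-distribˡ-+ , *-distribʳ-+ }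
  ; *-comm = *-comm }

+-*-commutativeRing : CommutativeRing _ _
+-*-commutativeRing = record { isCommutativeRing = +-*-isCommutativeRing }

open NonReflective (fromCommutativeRing +-*-commutativeRing (λ _ → nothing)) using (solve; _⊜_; _⊕_; _⊗_)

p+[z+z]≋p : ∀ p z → (p +₂ (z +₂ z)) ≋ p
p+[z+z]≋p p z = ≋-trans (+-cong ≋-refl (+-same z)) (+-identityʳ p)

+≋[]⇒≋ : ∀ p q → (p +₂ q) ≋ [] → p ≋ q
+≋[]⇒≋ p q p+q≋0 = begin
  p                   ≈⟨ p+[z+z]≋p p q ⟨
  p +₂ (q +₂ q)       ≈⟨ solve 2 (λ p q → (p ⊕ (q ⊕ q)) ⊜ ((p ⊕ q) ⊕ q)) ≋-refl p q ⟩
  (p +₂ q) +₂ q       ≈⟨ +-cong p+q≋0 ≋-refl ⟩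
  q                   ∎
  where open ≋-Reasoning

one₂≉[] : ¬ (one₂ ≋ [])
one₂≉[] e with coeff-≡ e zero
... | ()

record DegreeBelow (p : F2Poly) (d : ℕ) : Set where
  constructor degreeBelow
  field vanishes : ∀ i → d ≤ i → coeff₂ p i ≡ false
open DegreeBelow

DegreeBelow-mono : ∀ {p d e} → d ≤ e → DegreeBelow p d → DegreeBelow p e
DegreeBelow-mono d≤e h = degreeBelow (λ i e≤i → vanishes h i (ℕₚ.≤-trans d≤e e≤i))

DegreeBelow-cong : ∀ {p q d} → p ≋ q → DegreeBelow p d → DegreeBelow q d
DegreeBelow-cong e h = degreeBelow (λ i d≤i → trans (sym (coeff-≡ e i)) (vanishes h i d≤i))

DegreeBelow-[] : ∀ d → DegreeBelow [] d
DegreeBelow-[] d = degreeBelow (λ i _ → coeff-[] i)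

DegreeBelow-0⇒≋[] : ∀ {p} → DegreeBelow p 0 → p ≋ []
DegreeBelow-0⇒≋[] h = coeffwise (λ i → trans (vanishes h i z≤n) (sym (coeff-[] i)))

DegreeBelow-∷ : ∀ {c r d} → DegreeBelow r d → DegreeBelow (c ∷ r) (suc d)
DegreeBelow-∷ h = degreeBelow λ { (suc i) (s≤s d≤i) → vanishes h i d≤i }

DegreeBelow-lower : ∀ {p d} → DegreeBelow p (suc d) → coeff₂ p d ≡ false → DegreeBelow p d
DegreeBelow-lower {p} {d} h top = degreeBelow below
  where
  below : ∀ i → d ≤ i → coeff₂ p i ≡ false
  below i d≤i with ℕₚ.m≤n⇒m<n∨m≡n d≤i
  ... | inj₁ d<i = vanishes h i d<i
  ... | inj₂ refl = top

DegreeBelow-+ : ∀ {p q d} → DegreeBelow p d → DegreeBelow q d → DegreeBelow (p +₂ q) d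
DegreeBelow-+ {p} {q} hp hq = degreeBelow (λ i d≤i → trans (coeff-+ p q i) (cong₂ _xor_ (vanishes hp i d≤i) (vanishes hq i d≤i)))

DegreeBelow-scale : ∀ a {q d} → DegreeBelow q d → DegreeBelow (map (a ∧_) q) d
DegreeBelow-scale a {q} h = degreeBelow (λ i d≤i → trans (coeff-scale a q i) (trans (cong (a ∧_) (vanishes h i d≤i)) (∧-zeroʳ a)))

HasDeg₂⇒DegreeBelow : ∀ p {d} → HasDeg₂ p d → DegreeBelow p (suc d)
HasDeg₂⇒DegreeBelow p (_ , above) = degreeBelow above

HasDeg₂⇒≉[] : ∀ p {d} → HasDeg₂ p d → ¬ (p ≋ [])
HasDeg₂⇒≉[] p {d} (top , _) p≋0 with trans (sym top) (trans (coeff-≡ p≋0 d) (coeff-[] d))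
... | ()

HasDeg₂-DegreeBelow⇒< : ∀ p {d e} → HasDeg₂ p d → DegreeBelow p e → d < e
HasDeg₂-DegreeBelow⇒< p {d} {e} (top , _) h with e ℕₚ.≤? d
... | yes e≤d with trans (sym top) (vanishes h d e≤d)
...   | ()
HasDeg₂-DegreeBelow⇒< p _ _ | no e≰d = ℕₚ.≰⇒> e≰d

HasDeg₂-0⇒≋one₂ : ∀ p → HasDeg₂ p 0 → p ≋ one₂
HasDeg₂-0⇒≋one₂ p (top , above) = coeffwise (λ { zero → top ; (suc i) → above (suc i) (s≤s z≤n) })

≋[]⊎HasDeg₂ : ∀ p → p ≋ [] ⊎ Σ ℕ (HasDeg₂ p)
≋[]⊎HasDeg₂ [] = inj₁ ≋-refl
≋[]⊎HasDeg₂ (a ∷ p) with ≋[]⊎HasDeg₂ p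
≋[]⊎HasDeg₂ (false ∷ p) | inj₁ p≋0 = inj₁ (≋-trans (∷-cong refl p≋0) x·[])
≋[]⊎HasDeg₂ (true ∷ p)  | inj₁ p≋0 = inj₂ (0 , refl , λ { (suc i) _ → trans (coeff-≡ p≋0 i) (coeff-[] i) })
... | inj₂ (d , top , above) = inj₂ (suc d , top , λ { (suc i) (s≤s d<i) → above i d<i })

constant-* : ∀ a {p} q → p ≋ [] → ((a ∷ p) *₂ q) ≋ map (a ∧_) q
constant-* a q p≋0 = ≋-trans (+-cong ≋-refl (≋-trans (∷-cong refl (*-zeroˡ q p≋0)) x·[])) (+-identityʳ _)

*-DegreeBelow : ∀ p q {d e} → DegreeBelow p (suc d) → DegreeBelow q (suc e) → DegreeBelow (p *₂ q) (suc (d + e))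
*-DegreeBelow [] q hp hq = DegreeBelow-[] _
*-DegreeBelow (a ∷ p) q {zero} hp hq =
  DegreeBelow-cong (≋-sym (constant-* a q (DegreeBelow-0⇒≋[] {p} (degreeBelow (λ j _ → vanishes hp (suc j) (s≤s z≤n))))))
                   (DegreeBelow-scale a hq)
*-DegreeBelow (a ∷ p) q {suc d} {e} hp hq = DegreeBelow-+ {map (a ∧_) q}
  (DegreeBelow-mono (s≤s (ℕₚ.m≤n+m e (suc d))) (DegreeBelow-scale a hq))
  (DegreeBelow-∷ (*-DegreeBelow p q (degreeBelow (λ j d≤j → vanishes hp (suc j) (s≤s d≤j))) hq))

*-HasDeg₂ : ∀ p q {d e} → HasDeg₂ p d → HasDeg₂ q e → HasDeg₂ (p *₂ q) (d + e)
*-HasDeg₂ p q {d} {e} hp hq = top p d hp , vanishes (*-DegreeBelow p q (HasDeg₂⇒DegreeBelow p hp) (HasDeg₂⇒DegreeBelow q hq))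
  where
  top : ∀ p d → HasDeg₂ p d → coeff₂ (p *₂ q) (d + e) ≡ true
  top (a ∷ p) zero (a≡1 , above) =
    trans (coeff-≡ (constant-* a q (DegreeBelow-0⇒≋[] {p} (degreeBelow (λ j _ → above (suc j) (s≤s z≤n))))) e)
          (trans (coeff-scale a q e) (cong₂ _∧_ a≡1 (proj₁ hq)))
  top (a ∷ p) (suc d) (pd≡1 , above) =
    trans (coeff-+ (map (a ∧_) q) (x· (p *₂ q)) (suc (d + e)))
          (cong₂ _xor_ (vanishes (DegreeBelow-scale a (HasDeg₂⇒DegreeBelow q hq)) (suc (d + e)) (s≤s (ℕₚ.m≤n+m e d)))
                       (top p d (pd≡1 , λ i d<i → above (suc i) (s≤s d<i))))

*≋[]⇒≋[]⊎≋[] : ∀ p q → (p *₂ q) ≋ [] → p ≋ [] ⊎ q ≋ []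
*≋[]⇒≋[]⊎≋[] p q pq≋0 with ≋[]⊎HasDeg₂ p | ≋[]⊎HasDeg₂ q
... | inj₁ p≋0 | _ = inj₁ p≋0
... | inj₂ _ | inj₁ q≋0 = inj₂ q≋0
... | inj₂ (d , hp) | inj₂ (e , hq) = ⊥-elim (HasDeg₂⇒≉[] (p *₂ q) (*-HasDeg₂ p q hp hq) pq≋0)

*-cancelʳ : ∀ p q h → ¬ (h ≋ []) → (p *₂ h) ≋ (q *₂ h) → p ≋ q
*-cancelʳ p q h h≉0 ph≋qh with *≋[]⇒≋[]⊎≋[] (p +₂ q) h
  (≋-trans (*-distribʳ-+ h p q) (≋-trans (+-cong ph≋qh ≋-refl) (+-same (q *₂ h))))
... | inj₁ p+q≋0 = +≋[]⇒≋ p q p+q≋0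
... | inj₂ h≋0 = ⊥-elim (h≉0 h≋0)

*≋one₂⇒≋one₂ : ∀ p q → (p *₂ q) ≋ one₂ → p ≋ one₂
*≋one₂⇒≋one₂ p q pq≋1 with ≋[]⊎HasDeg₂ p | ≋[]⊎HasDeg₂ q
... | inj₁ p≋0 | _ = ⊥-elim (one₂≉[] (≋-trans (≋-sym pq≋1) (*-zeroˡ q p≋0)))
... | inj₂ _ | inj₁ q≋0 = ⊥-elim (one₂≉[] (≋-trans (≋-sym pq≋1) (≋-trans (*-comm p q) (*-zeroˡ p q≋0))))
... | inj₂ (d , hp) | inj₂ (e , hq)
  with HasDeg₂-DegreeBelow⇒< (p *₂ q) (*-HasDeg₂ p q hp hq) (DegreeBelow-cong (≋-sym pq≋1) (DegreeBelow-∷ (DegreeBelow-[] 0)))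
... | s≤s d+e≤0 rewrite ℕₚ.n≤0⇒n≡0 (ℕₚ.m+n≤o⇒m≤o d d+e≤0) = HasDeg₂-0⇒≋one₂ p hp

infix 4 _∣_
_∣_ : F2Poly → F2Poly → Set
g ∣ f = Σ F2Poly λ q → (q *₂ g) ≋ f

∣-cong : ∀ {g f f'} → f ≋ f' → g ∣ f → g ∣ f'
∣-cong f≋f' (q , qg≋f) = q , ≋-trans qg≋f f≋f'

-- Horner step: c + x·a = (x·q)·b + (c + x·r); once c + x·r reaches degree d,
-- b is subtracted once more.
divMod : ∀ b {d} → HasDeg₂ b d → ∀ a → Σ F2Poly λ q → Σ F2Poly λ r → a ≋ ((q *₂ b) +₂ r) × DegreeBelow r d
divMod b hb [] = [] , [] , ≋-refl , DegreeBelow-[] _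
divMod b {d} hb (c ∷ a) with divMod b hb a
... | q , r , a≋qb+r , r<d with coeff₂ (c ∷ r) d in top
...   | false = x· q , c ∷ r , ≋-sym c∷a≋x·qb+c∷r , DegreeBelow-lower (DegreeBelow-∷ r<d) top
  where
  c∷a≋x·qb+c∷r : ((x· q) *₂ b +₂ (c ∷ r)) ≋ (c ∷ a)
  c∷a≋x·qb+c∷r = ≋-trans (+-cong (+-cong (scale-false b) ≋-refl) ≋-refl) (∷-cong refl (≋-sym a≋qb+r))
...   | true = (true ∷ q) , (c ∷ r) +₂ b , c∷a≋[1+x·q]b+[c∷r+b] , DegreeBelow-lower
          (DegreeBelow-+ (DegreeBelow-∷ r<d) (HasDeg₂⇒DegreeBelow b hb))
          (trans (coeff-+ (c ∷ r) b d) (cong₂ _xor_ top (proj₁ hb)))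
  where
  open ≋-Reasoning
  c∷a≋[1+x·q]b+[c∷r+b] : (c ∷ a) ≋ (((true ∷ q) *₂ b) +₂ ((c ∷ r) +₂ b))
  c∷a≋[1+x·q]b+[c∷r+b] = begin
      c ∷ a
    ≈⟨ ∷-cong refl a≋qb+r ⟩
      x· (q *₂ b) +₂ (c ∷ r)
    ≈⟨ p+[z+z]≋p _ b ⟨
      (x· (q *₂ b) +₂ (c ∷ r)) +₂ (b +₂ b)
    ≈⟨ solve 3 (λ y b c → ((y ⊕ c) ⊕ (b ⊕ b)) ⊜ ((b ⊕ y) ⊕ (c ⊕ b))) ≋-refl (x· (q *₂ b)) b (c ∷ r) ⟩
      (b +₂ x· (q *₂ b)) +₂ ((c ∷ r) +₂ b)
    ≈⟨ +-cong (+-cong (scale-true b) ≋-refl) ≋-refl ⟨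
      ((true ∷ q) *₂ b) +₂ ((c ∷ r) +₂ b)
    ∎

module _ {p} (p-irr : MonicIrreducible₂ p) where

  private
    d = proj₁ (proj₁ p-irr)
    p-deg : HasDeg₂ p d
    p-deg = proj₂ (proj₂ (proj₁ p-irr))

  irreducible-split : ∀ g h → (g *₂ h) ≋ p → g ≋ one₂ ⊎ h ≋ one₂
  irreducible-split g h gh≋p with proj₂ p-irr g h (coeff-≡ gh≋p)
  ... | inj₁ g≈1 = inj₁ (coeffwise g≈1)
  ... | inj₂ h≈1 = inj₂ (coeffwise h≈1)

  irreducible-≉[] : ¬ (p ≋ [])
  irreducible-≉[] = HasDeg₂⇒≉[] p p-deg

  irreducible-∤one₂ : ¬ (p ∣ one₂)
  irreducible-∤one₂ (u , up≋1) with HasDeg₂-DegreeBelow⇒< p p-deg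
    (DegreeBelow-cong (≋-sym (*≋one₂⇒≋one₂ p u (≋-trans (*-comm p u) up≋1))) (DegreeBelow-∷ (DegreeBelow-[] 0)))
      | proj₁ (proj₂ (proj₁ p-irr))
  ... | s≤s z≤n | ()

  -- Induction on a bound k for deg a: dividing p by a, p also divides r·b
  -- for the remainder r, which has smaller degree.
  ∣*-lowDegree : ∀ k a b → DegreeBelow a k → DegreeBelow a d → p ∣ (a *₂ b) → a ≋ [] ⊎ p ∣ b
  ∣*-lowDegree zero a b a<0 _ _ = inj₁ (DegreeBelow-0⇒≋[] a<0)
  ∣*-lowDegree (suc k) a b a<k+1 a<d (u , up≋ab) with ≋[]⊎HasDeg₂ a
  ... | inj₁ a≋0 = inj₁ a≋0
  ... | inj₂ (e , a-deg) with divMod a a-deg p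
  ... | q , r , p≋qa+r , r<e
    with ∣*-lowDegree k r b
           (DegreeBelow-mono (ℕₚ.≤-pred (HasDeg₂-DegreeBelow⇒< a a-deg a<k+1)) r<e)
           (DegreeBelow-mono (ℕₚ.<⇒≤ (HasDeg₂-DegreeBelow⇒< a a-deg a<d)) r<e)
           (b +₂ (q *₂ u) , [b+qu]p≋rb)
    where
    open ≋-Reasoning
    [b+qu]p≋rb : ((b +₂ (q *₂ u)) *₂ p) ≋ (r *₂ b)
    [b+qu]p≋rb = begin
        (b +₂ (q *₂ u)) *₂ p
      ≈⟨ solve 4 (λ b q u p → ((b ⊕ q ⊗ u) ⊗ p) ⊜ (p ⊗ b ⊕ q ⊗ (u ⊗ p))) ≋-refl b q u p ⟩
        (p *₂ b) +₂ (q *₂ (u *₂ p))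
      ≈⟨ +-cong (*-congˡ b p≋qa+r) (*-congʳ q up≋ab) ⟩
        (((q *₂ a) +₂ r) *₂ b) +₂ (q *₂ (a *₂ b))
      ≈⟨ solve 4 (λ q a r b → (((q ⊗ a) ⊕ r) ⊗ b ⊕ q ⊗ (a ⊗ b))
                            ⊜ (r ⊗ b ⊕ (q ⊗ (a ⊗ b) ⊕ q ⊗ (a ⊗ b)))) ≋-refl q a r b ⟩
        (r *₂ b) +₂ ((q *₂ (a *₂ b)) +₂ (q *₂ (a *₂ b)))
      ≈⟨ p+[z+z]≋p _ (q *₂ (a *₂ b)) ⟩
        r *₂ b
      ∎
  ... | inj₂ p∣b = inj₂ p∣b
  ... | inj₁ r≋0 with irreducible-split q a (≋-sym p≋qa)
    where
    p≋qa : p ≋ (q *₂ a)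
    p≋qa = ≋-trans p≋qa+r (≋-trans (+-cong ≋-refl r≋0) (+-identityʳ _))
  ... | inj₂ a≋1 = inj₂ (u , ≋-trans up≋ab (≋-trans (*-congˡ b a≋1) (*-identityˡ b)))
  ... | inj₁ q≋1 = ⊥-elim (ℕₚ.<⇒≱ (HasDeg₂-DegreeBelow⇒< a a-deg a<d) (ℕₚ.≤-pred d<e+1))
    where
    d<e+1 : d < suc e
    d<e+1 = HasDeg₂-DegreeBelow⇒< p p-deg (DegreeBelow-cong (≋-sym p≋a) (HasDeg₂⇒DegreeBelow a a-deg))
      where
      p≋a : p ≋ a
      p≋a = ≋-trans p≋qa+r (≋-trans (+-cong ≋-refl r≋0) (≋-trans (+-identityʳ _) (≋-trans (*-congˡ a q≋1) (*-identityˡ a))))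

  euclid : ∀ a b → p ∣ (a *₂ b) → p ∣ a ⊎ p ∣ b
  euclid a b (u , up≋ab) with divMod p p-deg a
  ... | q , a₀ , a≋qp+a₀ , a₀<d with ∣*-lowDegree d a₀ b a₀<d a₀<d (u +₂ (q *₂ b) , [u+qb]p≋a₀b)
    where
    open ≋-Reasoning
    [u+qb]p≋a₀b : ((u +₂ (q *₂ b)) *₂ p) ≋ (a₀ *₂ b)
    [u+qb]p≋a₀b = begin
        (u +₂ (q *₂ b)) *₂ p
      ≈⟨ solve 4 (λ u q b p → ((u ⊕ q ⊗ b) ⊗ p) ⊜ (u ⊗ p ⊕ (q ⊗ p) ⊗ b)) ≋-refl u q b p ⟩
        (u *₂ p) +₂ ((q *₂ p) *₂ b)
      ≈⟨ +-cong (≋-trans up≋ab (*-congˡ b a≋qp+a₀)) ≋-refl ⟩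
        (((q *₂ p) +₂ a₀) *₂ b) +₂ ((q *₂ p) *₂ b)
      ≈⟨ solve 3 (λ y a b → (((y ⊕ a) ⊗ b) ⊕ y ⊗ b) ⊜ (a ⊗ b ⊕ (y ⊗ b ⊕ y ⊗ b))) ≋-refl (q *₂ p) a₀ b ⟩
        (a₀ *₂ b) +₂ (((q *₂ p) *₂ b) +₂ ((q *₂ p) *₂ b))
      ≈⟨ p+[z+z]≋p _ ((q *₂ p) *₂ b) ⟩
        a₀ *₂ b
      ∎
  ... | inj₁ a₀≋0 = inj₁ (q , ≋-sym (≋-trans a≋qp+a₀ (≋-trans (+-cong ≋-refl a₀≋0) (+-identityʳ _))))
  ... | inj₂ p∣b = inj₂ p∣b

square-+ : ∀ p q → ((p +₂ q) *₂ (p +₂ q)) ≋ ((p *₂ p) +₂ (q *₂ q))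
square-+ p q = begin
    (p +₂ q) *₂ (p +₂ q)
  ≈⟨ solve 2 (λ p q → ((p ⊕ q) ⊗ (p ⊕ q)) ⊜ ((p ⊗ p ⊕ q ⊗ q) ⊕ (p ⊗ q ⊕ p ⊗ q))) ≋-refl p q ⟩
    ((p *₂ p) +₂ (q *₂ q)) +₂ ((p *₂ q) +₂ (p *₂ q))
  ≈⟨ p+[z+z]≋p _ (p *₂ q) ⟩
    (p *₂ p) +₂ (q *₂ q)
  ∎
  where open ≋-Reasoning

square≋[]⇒≋[] : ∀ p → (p *₂ p) ≋ [] → p ≋ []
square≋[]⇒≋[] p pp≋0 with *≋[]⇒≋[]⊎≋[] p p pp≋0
... | inj₁ p≋0 = p≋0
... | inj₂ p≋0 = p≋0

dilate : F2Poly → F2Poly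
dilate [] = []
dilate (a ∷ p) = a ∷ false ∷ dilate p

square≋dilate : ∀ p → (p *₂ p) ≋ dilate p
square≋dilate [] = ≋-refl
square≋dilate (a ∷ p) = ∷-cong (a∧a⊕0≡a a) (begin
    map (a ∧_) p +₂ (p *₂ (a ∷ p))
  ≈⟨ +-cong ≋-refl (*-∷ʳ p a p) ⟩
    map (a ∧_) p +₂ (map (a ∧_) p +₂ x· (p *₂ p))
  ≈⟨ +-assoc (map (a ∧_) p) _ _ ⟨
    (map (a ∧_) p +₂ map (a ∧_) p) +₂ x· (p *₂ p)
  ≈⟨ +-cong (+-same (map (a ∧_) p)) (∷-cong refl (square≋dilate p)) ⟩
    x· dilate p
  ∎)
  where
  a∧a⊕0≡a : ∀ a → (a ∧ a) xor false ≡ a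
  a∧a⊕0≡a false = refl
  a∧a⊕0≡a true = refl
  open ≋-Reasoning

evens odds : F2Poly → F2Poly
evens [] = []
evens (a ∷ []) = a ∷ []
evens (a ∷ b ∷ p) = a ∷ evens p
odds [] = []
odds (a ∷ []) = []
odds (a ∷ b ∷ p) = b ∷ odds p

≋dilate-evens+x·dilate-odds : ∀ p → p ≋ (dilate (evens p) +₂ x· dilate (odds p))
≋dilate-evens+x·dilate-odds [] = ≋-sym x·[]
≋dilate-evens+x·dilate-odds (a ∷ []) = ∷-cong (sym (xor-identityʳ a)) (≋-sym x·[])
≋dilate-evens+x·dilate-odds (a ∷ b ∷ p) =
  ∷-cong (sym (xor-identityʳ a)) (∷-cong refl (≋dilate-evens+x·dilate-odds p))

isOdd : ℕ → Bool
isOdd zero = false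
isOdd (suc n) = not (isOdd n)

OfParity : Bool → F2Poly → Set
OfParity e p = ∀ i → coeff₂ p i ≡ true → isOdd i ≡ e

OfParity-cong : ∀ {e p q} → p ≋ q → OfParity e p → OfParity e q
OfParity-cong p≋q h i qi≡1 = h i (trans (coeff-≡ p≋q i) qi≡1)

OfParity-[] : ∀ e → OfParity e []
OfParity-[] e zero ()
OfParity-[] e (suc i) ()

OfParity-+ : ∀ {e} p q → OfParity e p → OfParity e q → OfParity e (p +₂ q)
OfParity-+ p q hp hq i p+q≡1 with coeff₂ p i in pᵢ | coeff₂ q i in qᵢ
... | true  | _     = hp i pᵢ
... | false | true  = hq i qᵢ
... | false | false with trans (sym p+q≡1) (trans (coeff-+ p q i) (cong₂ _xor_ pᵢ qᵢ))
...   | ()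

OfParity-x· : ∀ {e} p → OfParity e p → OfParity (not e) (x· p)
OfParity-x· p h (suc i) pᵢ≡1 = cong not (h i pᵢ≡1)

OfParity-∷ : ∀ {e} a p → OfParity e (a ∷ p) → OfParity (not e) p
OfParity-∷ a p h i pᵢ≡1 = trans (sym (not-involutive (isOdd i))) (cong not (h (suc i) pᵢ≡1))

OfParity-* : ∀ {a b} p q → OfParity a p → OfParity b q → OfParity (a xor b) (p *₂ q)
OfParity-* [] q hp hq = OfParity-[] _
OfParity-* {a} {b} (c ∷ p) q hp hq = OfParity-+ (map (c ∧_) q) (x· (p *₂ q)) (scaled c hp) shifted
  where
  scaled : ∀ c → OfParity a (c ∷ p) → OfParity (a xor b) (map (c ∧_) q)
  scaled false _ = OfParity-cong (≋-sym (scale-false q)) (OfParity-[] _)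
  scaled true h = subst (λ e → OfParity (e xor b) (map (true ∧_) q)) (h zero refl)
                        (OfParity-cong (≋-sym (scale-true q)) hq)
  shifted : OfParity (a xor b) (x· (p *₂ q))
  shifted = subst (λ e → OfParity e (x· (p *₂ q)))
                  (trans (cong not (sym (not-distribˡ-xor a b))) (not-involutive _))
                  (OfParity-x· (p *₂ q) (OfParity-* p q (OfParity-∷ c p hp) hq))

OfParity-dilate : ∀ p → OfParity false (dilate p)
OfParity-dilate [] = OfParity-[] false
OfParity-dilate (a ∷ p) zero _ = refl
OfParity-dilate (a ∷ p) (suc (suc i)) pᵢ≡1 = cong (λ b → not (not b)) (OfParity-dilate p i pᵢ≡1)

OfParity-square : ∀ p → OfParity false (p *₂ p)
OfParity-square p = OfParity-cong (≋-sym (square≋dilate p)) (OfParity-dilate p)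

OfParity-both⇒≋[] : ∀ p → OfParity true p → OfParity false p → p ≋ []
OfParity-both⇒≋[] p odd even = coeffwise (λ i → trans (coeffᵢ i (coeff₂ p i) refl) (sym (coeff-[] i)))
  where
  coeffᵢ : ∀ i b → coeff₂ p i ≡ b → coeff₂ p i ≡ false
  coeffᵢ i false pᵢ≡0 = pᵢ≡0
  coeffᵢ i true pᵢ≡1 with trans (sym (odd i pᵢ≡1)) (even i pᵢ≡1)
  ... | ()

-- Writing r = E² + x·O², the odd part x·(H·O)² = (s + H·E)² is a square,
-- so it vanishes by parity.
square≋square*⇒square : ∀ s H r → ¬ (H ≋ []) → (s *₂ s) ≋ ((H *₂ H) *₂ r) → r ≋ (evens r *₂ evens r)
square≋square*⇒square s H r H≉0 ss≋HHr = begin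
    r
  ≈⟨ r≋E²+xO² ⟩
    (E *₂ E) +₂ (X *₂ (O *₂ O))
  ≈⟨ +-cong ≋-refl (≋-trans (*-congʳ X (*-zeroˡ O O≋0)) (*-zeroʳ X)) ⟩
    (E *₂ E) +₂ []
  ≈⟨ +-identityʳ _ ⟩
    E *₂ E
  ∎
  where
  open ≋-Reasoning
  E = evens r
  O = odds r
  A = H *₂ E
  B = H *₂ O
  r≋E²+xO² : r ≋ ((E *₂ E) +₂ (X *₂ (O *₂ O)))
  r≋E²+xO² = ≋-trans (≋dilate-evens+x·dilate-odds r)
    (+-cong (≋-sym (square≋dilate E)) (≋-sym (≋-trans (X*≋x· (O *₂ O)) (∷-cong refl (square≋dilate O)))))
  xB²≋[s+A]² : (X *₂ (B *₂ B)) ≋ ((s +₂ A) *₂ (s +₂ A))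
  xB²≋[s+A]² = begin
      X *₂ (B *₂ B)
    ≈⟨ p+[z+z]≋p _ (A *₂ A) ⟨
      (X *₂ (B *₂ B)) +₂ ((A *₂ A) +₂ (A *₂ A))
    ≈⟨ solve 2 (λ y z → (y ⊕ (z ⊕ z)) ⊜ ((z ⊕ y) ⊕ z)) ≋-refl (X *₂ (B *₂ B)) (A *₂ A) ⟩
      ((A *₂ A) +₂ (X *₂ (B *₂ B))) +₂ (A *₂ A)
    ≈⟨ +-cong (solve 4 (λ h e x o → ((h ⊗ h) ⊗ ((e ⊗ e) ⊕ (x ⊗ (o ⊗ o))))
                                  ⊜ (((h ⊗ e) ⊗ (h ⊗ e)) ⊕ (x ⊗ ((h ⊗ o) ⊗ (h ⊗ o))))) ≋-refl H E X O) ≋-refl ⟨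
      ((H *₂ H) *₂ ((E *₂ E) +₂ (X *₂ (O *₂ O)))) +₂ (A *₂ A)
    ≈⟨ +-cong (≋-trans (*-congʳ (H *₂ H) (≋-sym r≋E²+xO²)) (≋-sym ss≋HHr)) ≋-refl ⟩
      (s *₂ s) +₂ (A *₂ A)
    ≈⟨ square-+ s A ⟨
      (s +₂ A) *₂ (s +₂ A)
    ∎
  xB²≋[] : (X *₂ (B *₂ B)) ≋ []
  xB²≋[] = OfParity-both⇒≋[] _
    (OfParity-cong (≋-sym (X*≋x· (B *₂ B))) (OfParity-x· (B *₂ B) (OfParity-square B)))
    (OfParity-cong (≋-sym xB²≋[s+A]²) (OfParity-square (s +₂ A)))
  O≋0 : O ≋ []
  O≋0 with *≋[]⇒≋[]⊎≋[] H O (square≋[]⇒≋[] B (∷≋[]⇒≋[] (≋-trans (≋-sym (X*≋x· (B *₂ B))) xB²≋[])))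
  ... | inj₁ H≋0 = ⊥-elim (H≉0 H≋0)
  ... | inj₂ O≋0 = O≋0

^₂-distribˡ-+-* : ∀ p a b → (p ^₂ (a + b)) ≋ ((p ^₂ a) *₂ (p ^₂ b))
^₂-distribˡ-+-* p zero b = ≋-sym (*-identityˡ _)
^₂-distribˡ-+-* p (suc a) b = ≋-trans (*-congʳ p (^₂-distribˡ-+-* p a b)) (≋-sym (*-assoc p (p ^₂ a) (p ^₂ b)))

⌈e/2⌉+⌈e/2⌉≡e+e%2 : ∀ e → ⌈ e /2⌉ + ⌈ e /2⌉ ≡ e + e % 2
⌈e/2⌉+⌈e/2⌉≡e+e%2 zero = refl
⌈e/2⌉+⌈e/2⌉≡e+e%2 (suc zero) = refl
⌈e/2⌉+⌈e/2⌉≡e+e%2 (suc (suc e)) =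
  cong suc (trans (ℕₚ.+-suc ⌈ e /2⌉ ⌈ e /2⌉) (cong suc (⌈e/2⌉+⌈e/2⌉≡e+e%2 e)))

^₂%2≋one₂⊎≋ : ∀ p e → (p ^₂ (e % 2)) ≋ one₂ ⊎ (p ^₂ (e % 2)) ≋ p
^₂%2≋one₂⊎≋ p zero = inj₁ ≋-refl
^₂%2≋one₂⊎≋ p (suc zero) = inj₂ (*-identityʳ p)
^₂%2≋one₂⊎≋ p (suc (suc e)) = ^₂%2≋one₂⊎≋ p e

Factorisation : Set
Factorisation = List (F2Poly × ℕ)

prod₂-map-* : ∀ {A : Set} (f g : A → F2Poly) xs →
  (prod₂ (map f xs) *₂ prod₂ (map g xs)) ≋ prod₂ (map (λ x → f x *₂ g x) xs)
prod₂-map-* f g [] = *-identityˡ one₂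
prod₂-map-* f g (x ∷ xs) = ≋-trans
  (solve 4 (λ a b c d → ((a ⊗ b) ⊗ (c ⊗ d)) ⊜ ((a ⊗ c) ⊗ (b ⊗ d))) ≋-refl
           (f x) (prod₂ (map f xs)) (g x) (prod₂ (map g xs)))
  (*-congʳ (f x *₂ g x) (prod₂-map-* f g xs))

prod₂-map-cong : ∀ {A : Set} {f g : A → F2Poly} xs → (∀ x → f x ≋ g x) → prod₂ (map f xs) ≋ prod₂ (map g xs)
prod₂-map-cong [] f≋g = ≋-refl
prod₂-map-cong (x ∷ xs) f≋g = *-cong (f≋g x) (prod₂-map-cong xs f≋g)

oddPowers : Factorisation → F2Poly
oddPowers fs = prod₂ (map (λ fe → proj₁ fe ^₂ (proj₂ fe % 2)) fs)

square-of-sqrt : ∀ s f fs → f ≋ prod₂ (map (λ fe → proj₁ fe ^₂ proj₂ fe) fs) →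
  s ≋ prod₂ (map (λ fe → proj₁ fe ^₂ ⌈ proj₂ fe /2⌉) fs) → (s *₂ s) ≋ (f *₂ oddPowers fs)
square-of-sqrt s f fs f≋ s≋ = begin
    s *₂ s
  ≈⟨ *-cong s≋ s≋ ⟩
    prod₂ (map half fs) *₂ prod₂ (map half fs)
  ≈⟨ prod₂-map-* half half fs ⟩
    prod₂ (map (λ fe → half fe *₂ half fe) fs)
  ≈⟨ prod₂-map-cong fs (λ (p , e) → ≋-trans (≋-sym (^₂-distribˡ-+-* p ⌈ e /2⌉ ⌈ e /2⌉))
       (≋-trans (≋-reflexive (cong (p ^₂_) (⌈e/2⌉+⌈e/2⌉≡e+e%2 e))) (^₂-distribˡ-+-* p e (e % 2)))) ⟩
    prod₂ (map (λ fe → full fe *₂ odd fe) fs)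
  ≈⟨ prod₂-map-* full odd fs ⟨
    prod₂ (map full fs) *₂ oddPowers fs
  ≈⟨ *-congˡ (oddPowers fs) f≋ ⟨
    f *₂ oddPowers fs
  ∎
  where
  open ≋-Reasoning
  half full odd : F2Poly × ℕ → F2Poly
  half (p , e) = p ^₂ ⌈ e /2⌉
  full (p , e) = p ^₂ e
  odd (p , e) = p ^₂ (e % 2)

irreducible-∣-irreducible⇒≋ : ∀ p q → MonicIrreducible₂ p → MonicIrreducible₂ q → p ∣ q → p ≋ q
irreducible-∣-irreducible⇒≋ p q p-irr q-irr (w , wp≋q) with irreducible-split q-irr w p wp≋q
... | inj₁ w≋1 = ≋-trans (≋-sym (≋-trans (*-congˡ p w≋1) (*-identityˡ p))) wp≋q
... | inj₂ p≋1 = ⊥-elim (irreducible-∤one₂ p-irr (one₂ , ≋-trans (*-identityˡ p) p≋1))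

∤oddPowers : ∀ p fs → MonicIrreducible₂ p → All (λ fe → MonicIrreducible₂ (proj₁ fe)) fs →
  All (λ fe → ¬ (p ≈₂ proj₁ fe)) fs → ¬ (p ∣ oddPowers fs)
∤oddPowers p [] p-irr [] [] p∣1 = irreducible-∤one₂ p-irr p∣1
∤oddPowers p ((q , e) ∷ fs) p-irr (q-irr ∷ irrs) (p≉q ∷ p≉) p∣ with euclid p-irr _ _ p∣
... | inj₂ p∣R = ∤oddPowers p fs p-irr irrs p≉ p∣R
... | inj₁ p∣qᵇ with ^₂%2≋one₂⊎≋ q e
...   | inj₁ qᵇ≋1 = irreducible-∤one₂ p-irr (∣-cong qᵇ≋1 p∣qᵇ)
...   | inj₂ qᵇ≋q = p≉q (coeff-≡ (irreducible-∣-irreducible⇒≋ p q p-irr q-irr (∣-cong qᵇ≋q p∣qᵇ)))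

-- An irreducible factor p of odd multiplicity in a square p·R divides R,
-- hence divides another factor, which then equals p.
oddPowers-square⇒≋one₂ : ∀ fs → All (λ fe → MonicIrreducible₂ (proj₁ fe)) fs →
  AllPairs (λ a b → ¬ (proj₁ a ≈₂ proj₁ b)) fs → ∀ t → oddPowers fs ≋ (t *₂ t) → oddPowers fs ≋ one₂
oddPowers-square⇒≋one₂ [] _ _ t _ = ≋-refl
oddPowers-square⇒≋one₂ ((p , e) ∷ fs) (p-irr ∷ irrs) (p≉ ∷ distinct) t pᵇR≋tt with ^₂%2≋one₂⊎≋ p e
... | inj₁ pᵇ≋1 = ≋-trans (*-congˡ R pᵇ≋1) (≋-trans (*-identityˡ R)
      (oddPowers-square⇒≋one₂ fs irrs distinct t (≋-trans (≋-sym (≋-trans (*-congˡ R pᵇ≋1) (*-identityˡ R))) pᵇR≋tt)))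
  where R = oddPowers fs
... | inj₂ pᵇ≋p = ⊥-elim (∤oddPowers p fs p-irr irrs p≉ p∣R)
  where
  open ≋-Reasoning
  R = oddPowers fs
  pR≋tt : (p *₂ R) ≋ (t *₂ t)
  pR≋tt = ≋-trans (*-congˡ R (≋-sym pᵇ≋p)) pᵇR≋tt
  p∣t : p ∣ t
  p∣t with euclid p-irr t t (R , ≋-trans (*-comm R p) pR≋tt)
  ... | inj₁ p∣t = p∣t
  ... | inj₂ p∣t = p∣t
  u = proj₁ p∣t
  p∣R : p ∣ R
  p∣R = (u *₂ u) , ≋-sym (*-cancelʳ R ((u *₂ u) *₂ p) p (irreducible-≉[] p-irr) (begin
      R *₂ p
    ≈⟨ ≋-trans (*-comm R p) pR≋tt ⟩
      t *₂ t
    ≈⟨ *-cong (proj₂ p∣t) (proj₂ p∣t) ⟨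
      (u *₂ p) *₂ (u *₂ p)
    ≈⟨ solve 2 (λ u p → ((u ⊗ p) ⊗ (u ⊗ p)) ⊜ (((u ⊗ u) ⊗ p) ⊗ p)) ≋-refl u p ⟩
      ((u *₂ u) *₂ p) *₂ p
    ∎))

-- s² = Φ·r, with r the product of the factors of odd multiplicity; r is a
-- square since Φ is, and squarefree, so r = 1.
IsSqrt₂-square : ∀ s Φ H → IsSqrt₂ s Φ → Φ ≋ (H *₂ H) → ¬ (H ≋ []) → s ≋ H
IsSqrt₂-square s Φ H (fs , irrs , distinct , Φ≈ , s≈) Φ≋HH H≉0 = +≋[]⇒≋ s H (square≋[]⇒≋[] (s +₂ H) (begin
    (s +₂ H) *₂ (s +₂ H)   ≈⟨ square-+ s H ⟩
    (s *₂ s) +₂ (H *₂ H)   ≈⟨ +-cong ss≋HH ≋-refl ⟩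
    (H *₂ H) +₂ (H *₂ H)   ≈⟨ +-same (H *₂ H) ⟩
    []                     ∎))
  where
  open ≋-Reasoning
  ss≋HHr : (s *₂ s) ≋ ((H *₂ H) *₂ oddPowers fs)
  ss≋HHr = ≋-trans (square-of-sqrt s Φ fs (coeffwise Φ≈) (coeffwise s≈)) (*-congˡ (oddPowers fs) Φ≋HH)
  r≋1 : oddPowers fs ≋ one₂
  r≋1 = oddPowers-square⇒≋one₂ fs irrs distinct (evens (oddPowers fs)) (square≋square*⇒square s H (oddPowers fs) H≉0 ss≋HHr)
  ss≋HH : (s *₂ s) ≋ (H *₂ H)
  ss≋HH = ≋-trans ss≋HHr (≋-trans (*-congʳ (H *₂ H) r≋1) (*-identityʳ _))

open Permanent +-*-commutativeRing +-same

divX : F2Poly → F2Poly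
divX [] = []
divX (a ∷ p) = p

coeff-divX : ∀ p i → coeff₂ (divX p) i ≡ coeff₂ p (suc i)
coeff-divX [] i = sym (coeff-[] i)
coeff-divX (a ∷ p) i = refl

divX-cong : ∀ {p q} → p ≋ q → divX p ≋ divX q
divX-cong {p} {q} p≋q = coeffwise (λ i → trans (coeff-divX p i) (trans (coeff-≡ p≋q (suc i)) (sym (coeff-divX q i))))

divX-+ : ∀ p q → divX (p +₂ q) ≋ (divX p +₂ divX q)
divX-+ [] q = ≋-refl
divX-+ (a ∷ p) [] = ≋-sym (+-identityʳ p)
divX-+ (a ∷ p) (b ∷ q) = ≋-refl

divX-pickSum : ∀ {A : Set} {k} (vs : Vec A k) g → divX (pickSum vs g) ≋ pickSum vs (λ w r → divX (g w r))
divX-pickSum [] g = ≋-refl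
divX-pickSum (x ∷ []) g = ≋-refl
divX-pickSum (x ∷ y ∷ ys) g = ≋-trans (divX-+ (g x (y ∷ ys)) _) (+-cong ≋-refl (divX-pickSum (y ∷ ys) _))

OfParity-divX : ∀ {e} p → OfParity e p → OfParity (not e) (divX p)
OfParity-divX [] _ = OfParity-[] _
OfParity-divX (a ∷ p) h = OfParity-∷ a p h

x·divX : ∀ p → OfParity true p → x· divX p ≋ p
x·divX [] _ = x·[]
x·divX (false ∷ p) _ = ≋-refl
x·divX (true ∷ p) odd with odd zero refl
... | ()

*-x· : ∀ p q → (p *₂ x· q) ≋ x· (p *₂ q)
*-x· p q = ≋-trans (*-∷ʳ p false q) (+-cong (scale-false p) ≋-refl)

-- For p of parity b, derivative b p is the formal derivative of p.
derivative : Bool → F2Poly → F2Poly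
derivative true p = divX p
derivative false p = []

derivative-cong : ∀ b {p q} → p ≋ q → derivative b p ≋ derivative b q
derivative-cong true = divX-cong
derivative-cong false _ = ≋-refl

pickSum-OfParity : ∀ {A : Set} {k} (vs : Vec A k) g e → (∀ w r → OfParity e (g w r)) → OfParity e (pickSum vs g)
pickSum-OfParity [] g e h = OfParity-[] e
pickSum-OfParity (x ∷ []) g e h = h x []
pickSum-OfParity (x ∷ y ∷ ys) g e h =
  OfParity-+ (g x (y ∷ ys)) _ (h x (y ∷ ys)) (pickSum-OfParity (y ∷ ys) _ e (λ w r → h w (x ∷ r)))

pickSum-DegreeBelow : ∀ {A : Set} {k} (vs : Vec A k) g d → (∀ w r → DegreeBelow (g w r) d) → DegreeBelow (pickSum vs g) d
pickSum-DegreeBelow [] g d h = DegreeBelow-[] d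
pickSum-DegreeBelow (x ∷ []) g d h = h x []
pickSum-DegreeBelow (x ∷ y ∷ ys) g d h =
  DegreeBelow-+ (h x (y ∷ ys)) (pickSum-DegreeBelow (y ∷ ys) _ d (λ w r → h w (x ∷ r)))

matchingSum-DegreeBelow : ∀ {I : Set} (M : I → I → F2Poly) → (∀ v w → DegreeBelow (M v w) 2) →
  ∀ {k} (vs : Vec I k) → DegreeBelow (matchingSum M vs) (suc k)
matchingSum-DegreeBelow {I} M M-deg = lengthInduction (λ {k} vs → DegreeBelow (matchingSum M vs) (suc k))
  (DegreeBelow-∷ (DegreeBelow-[] 0)) step
  where
  step : ∀ {k} v (vs : Vec I k) → DegreeBelow (matchingSum M vs) (suc k) →
    (∀ (r : Vec I (pred k)) → DegreeBelow (matchingSum M r) (suc (pred k))) →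
    DegreeBelow (matchingSum M (v ∷ vs)) (suc (suc k))
  step {k} v vs ih ihr = DegreeBelow-cong (≋-sym (matchingSum-step M v vs))
    (DegreeBelow-+ (*-DegreeBelow (M v v) (matchingSum M vs) {1} {k} (M-deg v v) ih) (matched vs ihr))
    where
    matched : ∀ {k} (vs : Vec I k) → (∀ (r : Vec I (pred k)) → DegreeBelow (matchingSum M r) (suc (pred k))) →
      DegreeBelow (pickSum vs (λ w r → sq M v w *₂ matchingSum M r)) (suc (suc k))
    matched [] _ = DegreeBelow-[] _
    matched {suc k} (y ∷ ys) ihr = pickSum-DegreeBelow (y ∷ ys) _ _ (λ w r →
      *-DegreeBelow (sq M v w) (matchingSum M r) {2} {k} (*-DegreeBelow (M v w) (M v w) {1} {1} (M-deg v w) (M-deg v w)) (ihr r))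

module _ {I : Set} (M : I → I → F2Poly) (M-diag : ∀ v → M v v ≋ X) where

  matchingSum-OfParity : ∀ {k} (vs : Vec I k) → OfParity (isOdd k) (matchingSum M vs)
  matchingSum-OfParity = lengthInduction (λ {k} vs → OfParity (isOdd k) (matchingSum M vs)) one₂-even step
    where
    one₂-even : OfParity false one₂
    one₂-even zero _ = refl

    step : ∀ {k} v (vs : Vec I k) → OfParity (isOdd k) (matchingSum M vs) →
      (∀ (r : Vec I (pred k)) → OfParity (isOdd (pred k)) (matchingSum M r)) →
      OfParity (isOdd (suc k)) (matchingSum M (v ∷ vs))
    step {k} v vs ih ihr = OfParity-cong (≋-sym (matchingSum-step M v vs))
      (OfParity-+ (M v v *₂ matchingSum M vs) _
        (OfParity-cong (*-congˡ (matchingSum M vs) (≋-sym (M-diag v))) (OfParity-* X (matchingSum M vs) X-odd ih))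
        (matched vs ihr))
      where
      X-odd : OfParity true X
      X-odd (suc zero) _ = refl
      matched : ∀ {k} (vs : Vec I k) → (∀ (r : Vec I (pred k)) → OfParity (isOdd (pred k)) (matchingSum M r)) →
        OfParity (isOdd (suc k)) (pickSum vs (λ w r → sq M v w *₂ matchingSum M r))
      matched [] _ = OfParity-[] _
      matched {suc k} (y ∷ ys) ihr = pickSum-OfParity (y ∷ ys) _ _ (λ w r →
        subst (λ e → OfParity e (sq M v w *₂ matchingSum M r)) (sym (not-involutive (isOdd k)))
              (OfParity-* (sq M v w) (matchingSum M r) (OfParity-square (M v w)) (ihr r)))

  private
    F = matchingSum M
    S = deletionSum M

    deletionSum-∷≋[] : ∀ {k} v (vs : Vec I (suc k)) → OfParity true (F vs) →
      S vs ≋ divX (F vs) → (∀ r → S r ≋ []) → S (v ∷ vs) ≋ []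
    deletionSum-∷≋[] v vs F-vs-odd S-vs S-r = begin
        S (v ∷ vs)
      ≈⟨ deletionSum-step M v vs ⟩
        F vs +₂ ((M v v *₂ S vs) +₂ pickSum vs (λ w r → sq M v w *₂ S r))
      ≈⟨ +-cong (≋-refl {F vs}) (+-cong (*-cong (M-diag v) S-vs)
           (pickSum-cong vs (λ w r → ≋-trans (*-congʳ (sq M v w) (S-r r)) (*-zeroʳ (sq M v w))))) ⟩
        F vs +₂ ((X *₂ divX (F vs)) +₂ pickSum vs (λ w r → []))
      ≈⟨ +-cong (≋-refl {F vs}) (≋-trans (+-cong (X*≋x· (divX (F vs))) (pickSum-0 vs))
           (≋-trans (+-identityʳ _) (x·divX (F vs) F-vs-odd))) ⟩
        F vs +₂ F vs
      ≈⟨ +-same (F vs) ⟩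
        []
      ∎
      where open ≋-Reasoning

    deletionSum-∷≋divX : ∀ {k} v (vs : Vec I (suc k)) → (∀ r → OfParity true (F r)) →
      S vs ≋ [] → (∀ r → S r ≋ divX (F r)) → S (v ∷ vs) ≋ divX (F (v ∷ vs))
    deletionSum-∷≋divX v vs F-r-odd S-vs S-r = begin
        S (v ∷ vs)
      ≈⟨ deletionSum-step M v vs ⟩
        F vs +₂ ((M v v *₂ S vs) +₂ pickSum vs (λ w r → sq M v w *₂ S r))
      ≈⟨ +-cong (≋-refl {F vs}) (≋-trans (+-cong (≋-trans (*-congʳ (M v v) S-vs) (*-zeroʳ (M v v)))
           (pickSum-cong vs (λ w r → *-congʳ (sq M v w) (S-r r)))) ≋-refl) ⟩
        F vs +₂ pickSum vs (λ w r → sq M v w *₂ divX (F r))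
      ≈⟨ +-cong (≋-refl {F vs}) (pickSum-cong vs (λ w r →
           ≋-trans (divX-cong (*-congʳ (sq M v w) (≋-sym (x·divX (F r) (F-r-odd r)))))
                   (divX-cong (*-x· (sq M v w) (divX (F r)))))) ⟨
        F vs +₂ pickSum vs (λ w r → divX (sq M v w *₂ F r))
      ≈⟨ +-cong (divX-cong (≋-trans (*-congˡ (F vs) (M-diag v)) (X*≋x· (F vs)))) (divX-pickSum vs _) ⟨
        divX (M v v *₂ F vs) +₂ divX (pickSum vs (λ w r → sq M v w *₂ F r))
      ≈⟨ ≋-trans (divX-cong (matchingSum-step M v vs)) (divX-+ (M v v *₂ F vs) _) ⟨
        divX (F (v ∷ vs))
      ∎
      where open ≋-Reasoning

  -- Jacobi's formula: the sum of the principal (k-1)-minors of M is the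
  -- derivative of det M.
  deletionSum≋derivative : ∀ {k} (vs : Vec I k) → deletionSum M vs ≋ derivative (isOdd k) (matchingSum M vs)
  deletionSum≋derivative = lengthInduction (λ {k} vs → S vs ≋ derivative (isOdd k) (F vs)) ≋-refl step
    where
    step : ∀ {k} v (vs : Vec I k) → S vs ≋ derivative (isOdd k) (F vs) →
      (∀ (r : Vec I (pred k)) → S r ≋ derivative (isOdd (pred k)) (F r)) →
      S (v ∷ vs) ≋ derivative (isOdd (suc k)) (F (v ∷ vs))
    step v [] _ _ = ≋-sym (divX-cong (≋-trans (+-identityʳ _) (≋-trans (*-identityʳ _) (M-diag v))))
    step {suc k} v vs@(_ ∷ _) ih ihr = by-parity (isOdd k) refl
      where
      by-parity : ∀ b → isOdd k ≡ b → S (v ∷ vs) ≋ derivative (not (not b)) (F (v ∷ vs))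
      by-parity false k-even = deletionSum-∷≋[] v vs
        (subst (λ b → OfParity (not b) (F vs)) k-even (matchingSum-OfParity vs))
        (subst (λ b → S vs ≋ derivative (not b) (F vs)) k-even ih)
        (λ r → subst (λ b → S r ≋ derivative b (F r)) k-even (ihr r))
      by-parity true k-odd = deletionSum-∷≋divX v vs
        (λ r → subst (λ b → OfParity b (F r)) k-odd (matchingSum-OfParity r))
        (subst (λ b → S vs ≋ derivative (not b) (F vs)) k-odd ih)
        (λ r → subst (λ b → S r ≋ derivative b (F r)) k-odd (ihr r))

isOdd-%2 : ∀ n → (n % 2 ≡ᵇ 1) ≡ isOdd n
isOdd-%2 zero = refl
isOdd-%2 (suc zero) = refl
isOdd-%2 (suc (suc n)) = trans (isOdd-%2 n) (sym (not-involutive (isOdd n)))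

isOdd-+ : ∀ m n → isOdd (m + n) ≡ isOdd m xor isOdd n
isOdd-+ zero n = refl
isOdd-+ (suc m) n = trans (cong not (isOdd-+ m n)) (not-distribˡ-xor (isOdd m) (isOdd n))

isOdd-* : ∀ m n → isOdd (m * n) ≡ isOdd m ∧ isOdd n
isOdd-* zero n = refl
isOdd-* (suc m) n = trans (isOdd-+ n (m * n)) (trans (cong (isOdd n xor_) (isOdd-* m n)) (b⊕a∧b≡¬a∧b (isOdd m) (isOdd n)))
  where
  b⊕a∧b≡¬a∧b : ∀ a b → b xor (a ∧ b) ≡ not a ∧ b
  b⊕a∧b≡¬a∧b false b = xor-identityʳ b
  b⊕a∧b≡¬a∧b true b = xor-same b

isOdd-⊖ : ∀ m n → isOdd ℤ.∣ m ⊖ n ∣ ≡ isOdd m xor isOdd n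
isOdd-⊖ zero zero = refl
isOdd-⊖ zero (suc n) = refl
isOdd-⊖ (suc m) zero = sym (xor-identityʳ _)
isOdd-⊖ (suc m) (suc n) = trans (cong (λ z → isOdd ℤ.∣ z ∣) (ℤₚ.[1+m]⊖[1+n]≡m⊖n m n))
  (trans (isOdd-⊖ m n) (sym (xor-annihilates-not (isOdd m) (isOdd n))))

reduceℤ≡isOdd : ∀ z → reduceℤ z ≡ isOdd ℤ.∣ z ∣
reduceℤ≡isOdd z = isOdd-%2 ℤ.∣ z ∣

reduceℤ-+ : ∀ a b → reduceℤ (a ℤ.+ b) ≡ reduceℤ a xor reduceℤ b
reduceℤ-+ a b = trans (reduceℤ≡isOdd (a ℤ.+ b))
  (trans (isOdd∣+∣ a b) (sym (cong₂ _xor_ (reduceℤ≡isOdd a) (reduceℤ≡isOdd b))))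
  where
  isOdd∣+∣ : ∀ a b → isOdd ℤ.∣ a ℤ.+ b ∣ ≡ isOdd ℤ.∣ a ∣ xor isOdd ℤ.∣ b ∣
  isOdd∣+∣ (ℤ.+ m) (ℤ.+ n) = isOdd-+ m n
  isOdd∣+∣ (ℤ.+ m) -[1+ n ] = isOdd-⊖ m (suc n)
  isOdd∣+∣ -[1+ m ] (ℤ.+ n) = trans (isOdd-⊖ n (suc m)) (xor-comm (isOdd n) _)
  isOdd∣+∣ -[1+ m ] -[1+ n ] = trans (not-involutive _) (trans (isOdd-+ m n) (sym (xor-annihilates-not (isOdd m) (isOdd n))))

reduceℤ-* : ∀ a b → reduceℤ (a ℤ.* b) ≡ reduceℤ a ∧ reduceℤ b
reduceℤ-* a b = trans (reduceℤ≡isOdd (a ℤ.* b)) (trans (cong isOdd (ℤₚ.abs-* a b))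
  (trans (isOdd-* ℤ.∣ a ∣ ℤ.∣ b ∣) (sym (cong₂ _∧_ (reduceℤ≡isOdd a) (reduceℤ≡isOdd b)))))

reduceℤ-neg : ∀ a → reduceℤ (ℤ.- a) ≡ reduceℤ a
reduceℤ-neg a = trans (reduceℤ≡isOdd (ℤ.- a)) (trans (cong isOdd (ℤₚ.∣-i∣≡∣i∣ a)) (sym (reduceℤ≡isOdd a)))

reduce-+ : ∀ p q → reduce (p +ᶻ q) ≡ reduce p +₂ reduce q
reduce-+ [] q = refl
reduce-+ (a ∷ p) [] = refl
reduce-+ (a ∷ p) (b ∷ q) = cong₂ _∷_ (reduceℤ-+ a b) (reduce-+ p q)

reduce-scale : ∀ c q → reduce (scaleZ c q) ≡ map (reduceℤ c ∧_) (reduce q)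
reduce-scale c [] = refl
reduce-scale c (b ∷ q) = cong₂ _∷_ (reduceℤ-* c b) (reduce-scale c q)

reduce-* : ∀ p q → reduce (p *ᶻ q) ≡ reduce p *₂ reduce q
reduce-* [] q = refl
reduce-* (a ∷ p) q = trans (reduce-+ (scaleZ a q) (0ℤ ∷ (p *ᶻ q)))
  (cong₂ _+₂_ (reduce-scale a q) (cong x·_ (reduce-* p q)))

reduce-neg : ∀ p → reduce (negZ p) ≡ reduce p
reduce-neg [] = refl
reduce-neg (a ∷ p) = cong₂ _∷_ (reduceℤ-neg a) (reduce-neg p)

reduce-signed : ∀ {n} (j : Fin n) p → reduce (signed j p) ≡ reduce p
reduce-signed zero p = refl
reduce-signed (suc j) p = trans (reduce-neg (signed j p)) (reduce-signed j p)

coeff₂-reduce : ∀ p i → coeff₂ (reduce p) i ≡ reduceℤ (coeffZ p i)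
coeff₂-reduce [] i = coeff-[] i
coeff₂-reduce (a ∷ p) zero = refl
coeff₂-reduce (a ∷ p) (suc i) = coeff₂-reduce p i

sumFin₂ : ∀ {n} → (Fin n → F2Poly) → F2Poly
sumFin₂ {zero} f = []
sumFin₂ {suc n} f = f zero +₂ sumFin₂ (λ j → f (suc j))

reduce-sumFin : ∀ {n} (f : Fin n → ZPoly) → reduce (sumFin f) ≡ sumFin₂ (λ j → reduce (f j))
reduce-sumFin {zero} f = refl
reduce-sumFin {suc n} f = trans (reduce-+ (f zero) (sumFin (λ j → f (suc j))))
  (cong (reduce (f zero) +₂_) (reduce-sumFin (λ j → f (suc j))))

sumFin₂-cong : ∀ {n} {f g : Fin n → F2Poly} → (∀ j → f j ≋ g j) → sumFin₂ f ≋ sumFin₂ g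
sumFin₂-cong {zero} e = ≋-refl
sumFin₂-cong {suc n} e = +-cong (e zero) (sumFin₂-cong (λ j → e (suc j)))

pickSum-tabulate : ∀ {n} {J : Set} (cs : Fin (suc n) → J) (g : J → Vec J n → F2Poly) →
  pickSum (tabulate cs) g ≋ sumFin₂ (λ j → g (cs j) (tabulate (λ c → cs (punchIn j c))))
pickSum-tabulate {zero} cs g = ≋-sym (+-identityʳ _)
pickSum-tabulate {suc n} cs g = +-cong ≋-refl (pickSum-tabulate (λ c → cs (suc c)) (λ w r → g w (cs zero ∷ r)))

-- The signs of the Laplace expansion disappear modulo 2.
reduce-det≋permanent : ∀ {n} {I J : Set} (Z : I → J → ZPoly) (rs : Fin n → I) (cs : Fin n → J) →
  reduce (det (λ a b → Z (rs a) (cs b))) ≋ permanent (λ i j → reduce (Z i j)) (tabulate rs) (tabulate cs)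
reduce-det≋permanent {zero} Z rs cs = ≋-refl
reduce-det≋permanent {suc n} Z rs cs = begin
    reduce (sumFin (λ j → signed j (Z (rs zero) (cs j) *ᶻ minor j)))
  ≡⟨ reduce-sumFin (λ j → signed j (Z (rs zero) (cs j) *ᶻ minor j)) ⟩
    sumFin₂ (λ j → reduce (signed j (Z (rs zero) (cs j) *ᶻ minor j)))
  ≈⟨ sumFin₂-cong (λ j → ≋-trans (≋-reflexive (trans (reduce-signed j _) (reduce-* (Z (rs zero) (cs j)) _)))
                                 (*-congʳ (reduce (Z (rs zero) (cs j))) (reduce-det≋permanent Z (λ r → rs (suc r)) (λ c → cs (punchIn j c))))) ⟩
    sumFin₂ (λ j → reduce (Z (rs zero) (cs j)) *₂ permanent Z₂ (tabulate (λ r → rs (suc r))) (tabulate (λ c → cs (punchIn j c))))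
  ≈⟨ pickSum-tabulate cs (λ c cs' → reduce (Z (rs zero) c) *₂ permanent Z₂ (tabulate (λ r → rs (suc r))) cs') ⟨
    permanent Z₂ (tabulate rs) (tabulate cs)
  ∎
  where
  open ≋-Reasoning
  Z₂ = λ i j → reduce (Z i j)
  minor : Fin (suc n) → ZPoly
  minor j = det (λ r c → Z (rs (suc r)) (cs (punchIn j c)))

even⊎odd : ∀ i → ∃ λ j → i ≡ 2 * j ⊎ i ≡ suc (2 * j)
even⊎odd zero = 0 , inj₁ refl
even⊎odd (suc i) with even⊎odd i
... | j , inj₁ refl = j , inj₂ refl
... | j , inj₂ refl = suc j , inj₁ (sym (ℕₚ.*-suc 2 j))

coeff-dilate-2* : ∀ h j → coeff₂ (dilate h) (2 * j) ≡ coeff₂ h j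
coeff-dilate-2* [] j = coeff-[] (2 * j)
coeff-dilate-2* (a ∷ h) zero = refl
coeff-dilate-2* (a ∷ h) (suc j) rewrite ℕₚ.+-suc j (j + 0) = coeff-dilate-2* h j

coeff-dilate-1+2* : ∀ h j → coeff₂ (dilate h) (suc (2 * j)) ≡ false
coeff-dilate-1+2* [] j = refl
coeff-dilate-1+2* (a ∷ h) zero = refl
coeff-dilate-1+2* (a ∷ h) (suc j) rewrite ℕₚ.+-suc j (j + 0) = coeff-dilate-1+2* h j

OfParity-false⇒≋dilate : ∀ p h → OfParity false p → (∀ j → coeff₂ p (2 * j) ≡ coeff₂ h j) → p ≋ dilate h
OfParity-false⇒≋dilate p h even evens≡ = coeffwise (λ i → by-parity i (even⊎odd i))
  where
  by-parity : ∀ i → (∃ λ j → i ≡ 2 * j ⊎ i ≡ suc (2 * j)) → coeff₂ p i ≡ coeff₂ (dilate h) i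
  by-parity i (j , inj₁ refl) = trans (evens≡ j) (sym (coeff-dilate-2* h j))
  by-parity i (j , inj₂ refl) = trans (odd-coeff (coeff₂ p i) refl) (sym (coeff-dilate-1+2* h j))
    where
    odd-coeff : ∀ b → coeff₂ p i ≡ b → coeff₂ p i ≡ false
    odd-coeff false pᵢ≡0 = pᵢ≡0
    odd-coeff true pᵢ≡1 with trans (sym (cong not (isOdd-* 2 j))) (even i pᵢ≡1)
    ... | ()

coeff₂-applyUpTo-< : ∀ (f : ℕ → Bool) k j → j < k → coeff₂ (applyUpTo f k) j ≡ f j
coeff₂-applyUpTo-< f (suc k) zero _ = refl
coeff₂-applyUpTo-< f (suc k) (suc j) (s≤s j<k) = coeff₂-applyUpTo-< (f ∘ suc) k j j<k

coeff₂-applyUpTo-≥ : ∀ (f : ℕ → Bool) k j → k ≤ j → coeff₂ (applyUpTo f k) j ≡ false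
coeff₂-applyUpTo-≥ f zero j _ = coeff-[] j
coeff₂-applyUpTo-≥ f (suc k) (suc j) (s≤s k≤j) = coeff₂-applyUpTo-≥ (f ∘ suc) k j k≤j

ε+2m∸2[m∸j]≡ε+2j : ∀ ε m j → j ≤ m → ε + 2 * m ∸ 2 * (m ∸ j) ≡ ε + 2 * j
ε+2m∸2[m∸j]≡ε+2j ε m j j≤m = begin
    ε + 2 * m ∸ 2 * (m ∸ j)     ≡⟨ ℕₚ.+-∸-assoc ε (ℕₚ.*-monoʳ-≤ 2 (ℕₚ.m∸n≤m m j)) ⟩
    ε + (2 * m ∸ 2 * (m ∸ j))   ≡⟨ cong (λ k → ε + (2 * m ∸ k)) (ℕₚ.*-distribˡ-∸ 2 m j) ⟩
    ε + (2 * m ∸ (2 * m ∸ 2 * j)) ≡⟨ cong (ε +_) (ℕₚ.m∸[m∸n]≡n (ℕₚ.*-monoʳ-≤ 2 j≤m)) ⟩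
    ε + 2 * j                   ∎
  where open ≡-Reasoning

module _ {n} (G : Graph n) where

  χ₂ χJ₂ : F2Poly
  χ₂ = reduce (χ G)
  χJ₂ = reduce (χJ G)

  h₂ : ℕ → F2Poly
  h₂ m = reduce (halfPoly G m)

  xI-A xI-[A+J] : Fin n → Fin n → ZPoly
  xI-A i j = (if does (i ≟ j) then 0ℤ ∷ 1ℤ ∷ [] else []) +ᶻ (ℤ.- adjMatrix G i j ∷ [])
  xI-[A+J] i j = (if does (i ≟ j) then 0ℤ ∷ 1ℤ ∷ [] else []) +ᶻ (ℤ.- adjPlusJ G i j ∷ [])

  xI+A xI+A+J : Fin n → Fin n → F2Poly
  xI+A i j = reduce (xI-A i j)
  xI+A+J i j = reduce (xI-[A+J] i j)

  xI+A-diag : ∀ i → xI+A i i ≋ X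
  xI+A-diag i with i ≟ i
  ... | no i≢i = ⊥-elim (i≢i refl)
  ... | yes _ rewrite irrefl G i = ≋-refl

  xI+A-offDiag : ∀ i j → i ≢ j → xI+A i j ≋ (adj G i j ∷ [])
  xI+A-offDiag i j i≢j with i ≟ j
  ... | yes i≡j = ⊥-elim (i≢j i≡j)
  ... | no _ with adj G i j
  ...   | true = ≋-refl
  ...   | false = ≋-refl

  xI+A-sym : ∀ i j → xI+A i j ≋ xI+A j i
  xI+A-sym i j = by-cases (i ≟ j)
    where
    by-cases : Dec (i ≡ j) → xI+A i j ≋ xI+A j i
    by-cases (yes refl) = ≋-refl
    by-cases (no i≢j) = ≋-trans (xI+A-offDiag i j i≢j)
      (≋-trans (∷-cong (Graph.sym G i j) ≋-refl) (≋-sym (xI+A-offDiag j i (≢-sym i≢j))))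

  xI+A-degree : ∀ i j → DegreeBelow (xI+A i j) 2
  xI+A-degree i j = by-cases (i ≟ j)
    where
    by-cases : Dec (i ≡ j) → DegreeBelow (xI+A i j) 2
    by-cases (yes refl) = DegreeBelow-cong (≋-sym (xI+A-diag i)) (DegreeBelow-∷ (DegreeBelow-∷ (DegreeBelow-[] 0)))
    by-cases (no i≢j) = DegreeBelow-cong (≋-sym (xI+A-offDiag i j i≢j))
      (DegreeBelow-mono (s≤s z≤n) (DegreeBelow-∷ (DegreeBelow-[] 0)))

  xI+A+J≋xI+A+1 : ∀ i j → xI+A+J i j ≋ (xI+A i j +₂ one₂)
  xI+A+J≋xI+A+1 i j = begin
      reduce (d +ᶻ (ℤ.- (a ℤ.+ 1ℤ) ∷ []))
    ≡⟨ reduce-+ d _ ⟩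
      reduce d +₂ (reduceℤ (ℤ.- (a ℤ.+ 1ℤ)) ∷ [])
    ≡⟨ cong (λ b → reduce d +₂ (b ∷ []))
         (trans (reduceℤ-neg (a ℤ.+ 1ℤ)) (trans (reduceℤ-+ a 1ℤ) (cong (_xor true) (sym (reduceℤ-neg a))))) ⟩
      reduce d +₂ ((reduceℤ (ℤ.- a) ∷ []) +₂ one₂)
    ≈⟨ +-assoc (reduce d) _ _ ⟨
      (reduce d +₂ (reduceℤ (ℤ.- a) ∷ [])) +₂ one₂
    ≡⟨ cong (_+₂ one₂) (reduce-+ d (ℤ.- a ∷ [])) ⟨
      xI+A i j +₂ one₂
    ∎
    where
    open ≋-Reasoning
    d = if does (i ≟ j) then 0ℤ ∷ 1ℤ ∷ [] else []
    a = adjMatrix G i j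

  xI+A+J-sym : ∀ i j → xI+A+J i j ≋ xI+A+J j i
  xI+A+J-sym i j = ≋-trans (xI+A+J≋xI+A+1 i j) (≋-trans (+-cong (xI+A-sym i j) ≋-refl) (≋-sym (xI+A+J≋xI+A+1 j i)))

  χ₂≋matchingSum : χ₂ ≋ matchingSum xI+A (allFin n)
  χ₂≋matchingSum = ≋-trans (reduce-det≋permanent xI-A (λ i → i) (λ i → i)) (permanent≈matchingSum xI+A xI+A-sym (allFin n))

  χJ₂≋χ₂+derivative : χJ₂ ≋ (χ₂ +₂ derivative (isOdd n) χ₂)
  χJ₂≋χ₂+derivative = begin
      χJ₂
    ≈⟨ ≋-trans (reduce-det≋permanent xI-[A+J] (λ i → i) (λ i → i)) (permanent≈matchingSum xI+A+J xI+A+J-sym (allFin n)) ⟩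
      matchingSum xI+A+J (allFin n)
    ≈⟨ matchingSum-+1 xI+A xI+A+J xI+A+J≋xI+A+1 (allFin n) ⟩
      matchingSum xI+A (allFin n) +₂ deletionSum xI+A (allFin n)
    ≈⟨ +-cong ≋-refl (deletionSum≋derivative xI+A xI+A-diag (allFin n)) ⟩
      matchingSum xI+A (allFin n) +₂ derivative (isOdd n) (matchingSum xI+A (allFin n))
    ≈⟨ +-cong χ₂≋matchingSum (derivative-cong (isOdd n) χ₂≋matchingSum) ⟨
      χ₂ +₂ derivative (isOdd n) χ₂
    ∎
    where open ≋-Reasoning

  χ₂-OfParity : OfParity (isOdd n) χ₂
  χ₂-OfParity = OfParity-cong (≋-sym χ₂≋matchingSum) (matchingSum-OfParity xI+A xI+A-diag (allFin n))

  χ₂-DegreeBelow : DegreeBelow χ₂ (suc n)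
  χ₂-DegreeBelow = DegreeBelow-cong (≋-sym χ₂≋matchingSum) (matchingSum-DegreeBelow xI+A xI+A-degree (allFin n))

  h₂≡applyUpTo : ∀ m → h₂ m ≡ applyUpTo (λ k → reduceℤ (charCoeff G (2 * (m ∸ k)))) (suc m)
  h₂≡applyUpTo m = trans (cong (map reduceℤ) (map-applyUpTo (λ k → k) c (suc m))) (map-applyUpTo c reduceℤ (suc m))
    where c = λ k → charCoeff G (2 * (m ∸ k))

  coeff-h₂ : ∀ ε m → n ≡ ε + 2 * m → ∀ j → coeff₂ (h₂ m) j ≡ coeff₂ χ₂ (ε + 2 * j)
  coeff-h₂ ε m refl j with j ℕₚ.≤? m
  ... | yes j≤m = begin
      coeff₂ (h₂ m) j                                   ≡⟨ cong (λ p → coeff₂ p j) (h₂≡applyUpTo m) ⟩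
      coeff₂ (applyUpTo c₂ (suc m)) j                   ≡⟨ coeff₂-applyUpTo-< c₂ (suc m) j (s≤s j≤m) ⟩
      reduceℤ (coeffZ (χ G) (ε + 2 * m ∸ 2 * (m ∸ j)))  ≡⟨ coeff₂-reduce (χ G) _ ⟨
      coeff₂ χ₂ (ε + 2 * m ∸ 2 * (m ∸ j))               ≡⟨ cong (coeff₂ χ₂) (ε+2m∸2[m∸j]≡ε+2j ε m j j≤m) ⟩
      coeff₂ χ₂ (ε + 2 * j)                             ∎
    where
    open ≡-Reasoning
    c₂ = λ k → reduceℤ (charCoeff G (2 * (m ∸ k)))
  ... | no j≰m = begin
      coeff₂ (h₂ m) j                   ≡⟨ cong (λ p → coeff₂ p j) (h₂≡applyUpTo m) ⟩
      coeff₂ (applyUpTo c₂ (suc m)) j   ≡⟨ coeff₂-applyUpTo-≥ c₂ (suc m) j (ℕₚ.≰⇒> j≰m) ⟩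
      false                             ≡⟨ vanishes χ₂-DegreeBelow (ε + 2 * j) n<ε+2j ⟨
      coeff₂ χ₂ (ε + 2 * j)             ∎
    where
    open ≡-Reasoning
    c₂ = λ k → reduceℤ (charCoeff G (2 * (m ∸ k)))
    n<ε+2j : suc (ε + 2 * m) ≤ ε + 2 * j
    n<ε+2j = ℕₚ.≤-trans (ℕₚ.≤-reflexive (sym (ℕₚ.+-suc ε (2 * m))))
                        (ℕₚ.+-monoʳ-≤ ε (ℕₚ.*-monoʳ-< 2 (ℕₚ.≰⇒> j≰m)))

IsMonicGcd₂⇒≋ : ∀ {Φ f g} K u v → IsMonicGcd₂ Φ f g → K ∣ f → K ∣ g → ((u *₂ f) +₂ (v *₂ g)) ≋ K → Φ ≋ K
IsMonicGcd₂⇒≋ {Φ} {f} {g} K u v ((_ , Φ-deg) , (a , aΦ≈f) , (b , bΦ≈g) , greatest)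
  (k₁ , k₁K≋f) (k₂ , k₂K≋g) uf+vg≋K = begin
    Φ           ≈⟨ qK≋Φ ⟨
    q *₂ K      ≈⟨ *-congˡ K q≋1 ⟩
    one₂ *₂ K   ≈⟨ *-identityˡ K ⟩
    K           ∎
  where
  open ≋-Reasoning
  K∣Φ = greatest K (k₁ , coeff-≡ k₁K≋f) (k₂ , coeff-≡ k₂K≋g)
  q = proj₁ K∣Φ
  qK≋Φ : (q *₂ K) ≋ Φ
  qK≋Φ = coeffwise (proj₂ K∣Φ)
  c = (u *₂ a) +₂ (v *₂ b)
  cΦ≋K : (c *₂ Φ) ≋ K
  cΦ≋K = begin
      ((u *₂ a) +₂ (v *₂ b)) *₂ Φ
    ≈⟨ solve 5 (λ u a v b Φ → (((u ⊗ a) ⊕ (v ⊗ b)) ⊗ Φ) ⊜ ((u ⊗ (a ⊗ Φ)) ⊕ (v ⊗ (b ⊗ Φ))))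
               ≋-refl u a v b Φ ⟩
      (u *₂ (a *₂ Φ)) +₂ (v *₂ (b *₂ Φ))
    ≈⟨ +-cong (*-congʳ u (coeffwise aΦ≈f)) (*-congʳ v (coeffwise bΦ≈g)) ⟩
      (u *₂ f) +₂ (v *₂ g)
    ≈⟨ uf+vg≋K ⟩
      K
    ∎
  K≉0 : ¬ (K ≋ [])
  K≉0 K≋0 = HasDeg₂⇒≉[] Φ Φ-deg (≋-trans (≋-sym qK≋Φ) (≋-trans (*-congʳ q K≋0) (*-zeroʳ q)))
  cq≋1 : (c *₂ q) ≋ one₂
  cq≋1 = *-cancelʳ (c *₂ q) one₂ K K≉0 (begin
      (c *₂ q) *₂ K   ≈⟨ *-assoc c q K ⟩
      c *₂ (q *₂ K)   ≈⟨ *-congʳ c qK≋Φ ⟩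
      c *₂ Φ          ≈⟨ cΦ≋K ⟩
      K               ≈⟨ *-identityˡ K ⟨
      one₂ *₂ K       ∎)
  q≋1 : q ≋ one₂
  q≋1 = *≋one₂⇒≋one₂ q c (≋-trans (*-comm q c) cq≋1)

cofactor-of-sqrt : ∀ {Φ s} f H Q → Monic₂ Φ → IsSqrt₂ s Φ → Φ ≋ (H *₂ H) →
  (f *₂ s) ≋ (Q *₂ (H *₂ H)) → f ≋ (Q *₂ H)
cofactor-of-sqrt {Φ} {s} f H Q (_ , Φ-deg) s-sqrt Φ≋HH fs≋QHH = *-cancelʳ f (Q *₂ H) H H≉0 (begin
    f *₂ H            ≈⟨ *-congʳ f s≋H ⟨
    f *₂ s            ≈⟨ fs≋QHH ⟩
    Q *₂ (H *₂ H)     ≈⟨ *-assoc Q H H ⟨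
    (Q *₂ H) *₂ H     ∎)
  where
  open ≋-Reasoning
  H≉0 : ¬ (H ≋ [])
  H≉0 H≋0 = HasDeg₂⇒≉[] Φ Φ-deg (≋-trans Φ≋HH (*-zeroˡ H H≋0))
  s≋H : s ≋ H
  s≋H = IsSqrt₂-square s Φ H s-sqrt Φ≋HH H≉0

module _ (m : ℕ) where

  χ₂-even : (G : Graph (2 * m)) → χ₂ G ≋ (h₂ G m *₂ h₂ G m)
  χ₂-even G = ≋-trans
    (OfParity-false⇒≋dilate (χ₂ G) H (subst (λ b → OfParity b (χ₂ G)) (isOdd-* 2 m) (χ₂-OfParity G))
      (λ j → sym (coeff-h₂ G 0 m refl j)))
    (≋-sym (square≋dilate H))
    where H = h₂ G m

  χJ₂-even : (G : Graph (2 * m)) → χJ₂ G ≋ χ₂ G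
  χJ₂-even G = ≋-trans
    (subst (λ b → χJ₂ G ≋ (χ₂ G +₂ derivative b (χ₂ G))) (isOdd-* 2 m) (χJ₂≋χ₂+derivative G))
    (+-identityʳ _)

  χ₂-OfParity-true : (G : Graph (suc (2 * m))) → OfParity true (χ₂ G)
  χ₂-OfParity-true G = subst (λ b → OfParity (not b) (χ₂ G)) (isOdd-* 2 m) (χ₂-OfParity G)

  divX-χ₂-odd : (G : Graph (suc (2 * m))) → divX (χ₂ G) ≋ (h₂ G m *₂ h₂ G m)
  divX-χ₂-odd G = ≋-trans
    (OfParity-false⇒≋dilate (divX (χ₂ G)) H (OfParity-divX (χ₂ G) (χ₂-OfParity-true G))
      (λ j → trans (coeff-divX (χ₂ G) (2 * j)) (sym (coeff-h₂ G 1 m refl j))))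
    (≋-sym (square≋dilate H))
    where H = h₂ G m

  χ₂-odd : (G : Graph (suc (2 * m))) → χ₂ G ≋ (X *₂ (h₂ G m *₂ h₂ G m))
  χ₂-odd G = ≋-trans (≋-sym (x·divX (χ₂ G) (χ₂-OfParity-true G)))
    (≋-trans (∷-cong refl (divX-χ₂-odd G)) (≋-sym (X*≋x· _)))

  χJ₂-odd : (G : Graph (suc (2 * m))) →
    χJ₂ G ≋ ((X *₂ (h₂ G m *₂ h₂ G m)) +₂ (h₂ G m *₂ h₂ G m))
  χJ₂-odd G = ≋-trans
    (subst (λ b → χJ₂ G ≋ (χ₂ G +₂ derivative (not b) (χ₂ G))) (isOdd-* 2 m) (χJ₂≋χ₂+derivative G))
    (+-cong (χ₂-odd G) (divX-χ₂-odd G))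

  Φ₂-even : ∀ {Φ} (G : Graph (2 * m)) → IsMonicGcd₂ Φ (χ₂ G) (χJ₂ G) →
    Φ ≋ (h₂ G m *₂ h₂ G m)
  Φ₂-even G gcd = IsMonicGcd₂⇒≋ K one₂ [] gcd
    (one₂ , ≋-trans (*-identityˡ K) (≋-sym (χ₂-even G)))
    (one₂ , ≋-trans (*-identityˡ K) (≋-sym (≋-trans (χJ₂-even G) (χ₂-even G))))
    (≋-trans (+-identityʳ _) (≋-trans (*-identityˡ _) (χ₂-even G)))
    where K = h₂ G m *₂ h₂ G m

  Φ₂-odd : ∀ {Φ} (G : Graph (suc (2 * m))) → IsMonicGcd₂ Φ (χ₂ G) (χJ₂ G) →
    Φ ≋ (h₂ G m *₂ h₂ G m)
  Φ₂-odd G gcd = IsMonicGcd₂⇒≋ K one₂ one₂ gcd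
    (X , ≋-sym (χ₂-odd G))
    (X +₂ one₂ , ≋-trans (*-distribʳ-+ K X one₂)
                   (≋-trans (+-cong (≋-refl {X *₂ K}) (*-identityˡ K)) (≋-sym (χJ₂-odd G))))
    (begin
      (one₂ *₂ χ₂ G) +₂ (one₂ *₂ χJ₂ G)
    ≈⟨ +-cong (≋-trans (*-identityˡ _) (χ₂-odd G)) (≋-trans (*-identityˡ _) (χJ₂-odd G)) ⟩
      (X *₂ K) +₂ ((X *₂ K) +₂ K)
    ≈⟨ +-assoc (X *₂ K) (X *₂ K) K ⟨
      ((X *₂ K) +₂ (X *₂ K)) +₂ K
    ≈⟨ +-cong (+-same (X *₂ K)) ≋-refl ⟩
      K
    ∎)
    where
    open ≋-Reasoning
    K = h₂ G m *₂ h₂ G m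

theorem4p1 : (n : ℕ) (G : Graph n) (Φ s : F2Poly) (f : ZPoly) →
    IsMonicGcd₂ Φ (reduce (χ G)) (reduce (χJ G)) →
    IsSqrt₂ s Φ →
    MonicZ f →
    reduce f *₂ s ≈₂ reduce (χ G) →
    (∀ m → n ≡ 2 * m → reduce f ≈₂ reduce (halfPoly G m)) ×
    (∀ m → n ≡ suc (2 * m) → reduce f ≈₂ reduce (0ℤ ∷ halfPoly G m))
theorem4p1 n G Φ s f gcd s-sqrt _ fs≈χ = even , odd
  where
  even : ∀ m → n ≡ 2 * m → reduce f ≈₂ reduce (halfPoly G m)
  even m refl = coeff-≡ (≋-trans
    (cofactor-of-sqrt (reduce f) H one₂ (proj₁ gcd) s-sqrt (Φ₂-even m G gcd)
      (≋-trans (coeffwise fs≈χ) (≋-trans (χ₂-even m G) (≋-sym (*-identityˡ _)))))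
    (*-identityˡ H))
    where H = h₂ G m
  odd : ∀ m → n ≡ suc (2 * m) → reduce f ≈₂ reduce (0ℤ ∷ halfPoly G m)
  odd m refl = coeff-≡ (≋-trans
    (cofactor-of-sqrt (reduce f) H X (proj₁ gcd) s-sqrt (Φ₂-odd m G gcd)
      (≋-trans (coeffwise fs≈χ) (χ₂-odd m G)))
    (X*≋x· H))
    where H = h₂ G m
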